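{- Let $K$ be a $(d-1)$-dimensional cubical complex. If the cubical $h$-vector of $K$ is symmetric, then so is the cubical $h$-vector of its cubical barycentric subdivision $\mathrm{sd}_c(K)$.
   Context: A cubical complex is a finite collection $K$ of polytopes in $\mathbb{R}^n$, each combinatorially isomorphic to a cube $[0,1]^m$, closed under taking faces and such that any two intersect in a common face; $f_j(K)$ is its number of $j$-dimensional faces. For a $(d-1)$-dimensional cubical complex $K$, the short cubical $h$-vector is defined by $\sum_{i=0}^{d-1} h^{(sc)}_i(K)x^i = \sum_{j=0}^{d-1} f_j(K)(2x)^j(1-x)^{d-1-j}$, and the (long) cubical $h$-vector $(h^{(c)}_0(K),\ldots,h^{(c)}_d(K))$ is defined by $h^{(c)}_0(K)=2^{d-1}$ and $h^{(sc)}_i(K)=h^{(c)}_i(K)+h^{(c)}_{i+1}(K)$ for $0\le i\le d-1$. The vector $(a_0,\ldots,a_d)$ is symmetric if $a_i=a_{d-i}$ for all $i$. The cubical barycentric subdivision $\mathrm{sd}_c(K)$ is the cubical complex whose vertices are the barycenters of the nonempty faces of $K$ and whose nonempty faces are, for each closed interval $[F,G]$ in the poset of nonempty faces of $K$ ordered by inclusion, the convex hull of the barycenters of the faces in $[F,G]$; it has the same dimension as $K$. -}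

module Defs where

open import Data.Bool using (Bool; true; false; _∧_; if_then_else_)
open import Data.Nat as ℕ using (ℕ; zero; suc; _≤_; _∸_; _≡ᵇ_)
open import Data.Integer as ℤ using (ℤ; +_; -_)
open import Data.Fin using (Fin)
open import Data.Fin.Subset using (Subset; _∈_; _⊆_; _∩_; Nonempty)
open import Data.Fin.Subset.Properties using (_⊆?_)
open import Data.Vec using (Vec; []; _∷_)
open import Data.List using (List; []; _∷_; map; concatMap; length; filter; _++_)
open import Data.Product using (Σ; _×_; _,_; ∃)
open import Function using (_⇔_)
open import Relation.Binary.PropositionalEquality using (_≡_)
open import Relation.Nullary.Decidable using (⌊_⌋)
open import Function.Definitions using (Injective)

-- The standard cube [0,1]^m, combinatorially.
-- Vertices of [0,1]^m: Vec Bool m.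
-- Nonempty faces of [0,1]^m: Vec CubeCoord m, each coordinate fixed to 0,
-- fixed to 1, or free (∗).

data CubeCoord : Set where
  fix0 fix1 free : CubeCoord

data _lies-in_ : {m : ℕ} → Vec Bool m → Vec CubeCoord m → Set where
  []   : [] lies-in []
  on0  : ∀ {m} {v : Vec Bool m} {c} → v lies-in c → (false ∷ v) lies-in (fix0 ∷ c)
  on1  : ∀ {m} {v : Vec Bool m} {c} → v lies-in c → (true ∷ v) lies-in (fix1 ∷ c)
  onF  : ∀ {m} {v : Vec Bool m} {c} b → v lies-in c → (b ∷ v) lies-in (free ∷ c)

-- A face is recorded by its vertex set (a subset of Fin n); every face S
-- comes with a dimension and a labelling of its vertices by the vertices
-- of the cube [0,1]^(dim S), such that the faces of K contained in S are
-- exactly the images of the faces of the cube (so each face is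
-- combinatorially a cube, and K is closed under taking faces), and any
-- two faces intersect in a common face (or in the empty set).

record CubicalComplex (n : ℕ) : Set where
  field
    isFace   : Subset n → Bool
    dim      : Subset n → ℕ
    vert     : (S : Subset n) → isFace S ≡ true → Vec Bool (dim S) → Fin n
    vert-inj : (S : Subset n) (p : isFace S ≡ true) → Injective _≡_ _≡_ (vert S p)
    vert-set : (S : Subset n) (p : isFace S ≡ true) (x : Fin n) →
               (x ∈ S) ⇔ (∃ λ v → vert S p v ≡ x)
    faces-of-face : (S : Subset n) (p : isFace S ≡ true) (T : Subset n) → T ⊆ S →
               (isFace T ≡ true) ⇔
               (∃ λ (c : Vec CubeCoord (dim S)) → (x : Fin n) →
                  (x ∈ T) ⇔ (∃ λ v → (v lies-in c) × (vert S p v ≡ x)))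
    intersect : (S T : Subset n) → isFace S ≡ true → isFace T ≡ true →
               Nonempty (S ∩ T) → isFace (S ∩ T) ≡ true

open CubicalComplex public

allSubsets : (n : ℕ) → List (Subset n)
allSubsets zero    = [] ∷ []
allSubsets (suc n) = map (false ∷_) (allSubsets n) ++ map (true ∷_) (allSubsets n)

count : {A : Set} → (A → Bool) → List A → ℕ
count p xs = length (filter (λ x → Data.Bool._≟_ (p x) true) xs)
  where import Data.Bool

faces : {n : ℕ} → CubicalComplex n → List (Subset n)
faces {n} K = filter (λ S → Data.Bool._≟_ (isFace K S) true) (allSubsets n)
  where import Data.Bool

fvec : {n : ℕ} → CubicalComplex n → ℕ → ℕ
fvec K j = count (λ S → dim K S ≡ᵇ j) (faces K)

-- K is (d-1)-dimensional: all faces have dimension ≤ d-1, and some face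
-- has dimension exactly d-1 (so in particular K is nonempty and d ≥ 1).
HasDimension : {n : ℕ} → CubicalComplex n → ℕ → Set
HasDimension {n} K d =
  ((S : Subset n) → isFace K S ≡ true → suc (dim K S) ≤ d) ×
  (∃ λ S → (isFace K S ≡ true) × (suc (dim K S) ≡ d))

-- Its nonempty faces are in bijection with the closed intervals [F,G]
-- (F ⊆ G nonempty faces of K); the face corresponding to [F,G] is the
-- convex hull of the barycenters of the faces in [F,G], a cube of
-- dimension dim G - dim F (the interval [F,G] in the face lattice of the
-- cube G is a Boolean lattice of rank dim G - dim F).

sdFaces : {n : ℕ} → CubicalComplex n → List (Subset n × Subset n)
sdFaces K = concatMap (λ G → concatMap (λ F →
              if ⌊ F ⊆? G ⌋ then (F , G) ∷ [] else []) (faces K)) (faces K)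

sdDim : {n : ℕ} → CubicalComplex n → Subset n × Subset n → ℕ
sdDim K (F , G) = dim K G ∸ dim K F

fvec-sd : {n : ℕ} → CubicalComplex n → ℕ → ℕ
fvec-sd K j = count (λ I → sdDim K I ≡ᵇ j) (sdFaces K)

-- Integer polynomials as coefficient lists (constant term first).

Poly : Set
Poly = List ℤ

_+P_ : Poly → Poly → Poly
[]       +P q        = q
(a ∷ p)  +P []       = a ∷ p
(a ∷ p)  +P (b ∷ q)  = (a ℤ.+ b) ∷ (p +P q)

scale : ℤ → Poly → Poly
scale a = map (a ℤ.*_)

_*P_ : Poly → Poly → Poly
[]      *P q = []
(a ∷ p) *P q = scale a q +P (+ 0 ∷ (p *P q))

_^P_ : Poly → ℕ → Poly
p ^P zero  = + 1 ∷ []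
p ^P suc k = p *P (p ^P k)

coeff : Poly → ℕ → ℤ
coeff []      _       = + 0
coeff (a ∷ p) zero    = a
coeff (a ∷ p) (suc i) = coeff p i

polyX : Poly
polyX = + 0 ∷ + 1 ∷ []

sumP : ℕ → (ℕ → Poly) → Poly
sumP zero    P = []
sumP (suc k) P = sumP k P +P P k

shortPoly : ℕ → (ℕ → ℕ) → Poly
shortPoly d f = sumP d (λ j →
  scale (+ f j) (((+ 0 ∷ + 2 ∷ []) ^P j) *P ((+ 1 ∷ - (+ 1) ∷ []) ^P (d ∸ 1 ∸ j))))

hsc : ℕ → (ℕ → ℕ) → ℕ → ℤ
hsc d f i = coeff (shortPoly d f) i

hc : ℕ → (ℕ → ℕ) → ℕ → ℤ
hc d f zero    = + (2 ℕ.^ (d ∸ 1))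
hc d f (suc i) = hsc d f i ℤ.- hc d f i

Symmetric : ℕ → (ℕ → ℤ) → Set
Symmetric d a = (i : ℕ) → i ≤ d → a i ≡ a (d ∸ i)

-- Write f(a , b) = ∑ⱼ fⱼ aʲ bᵐ⁻ʲ (m = d - 1) for the homogenised f-polynomial of K. The short
-- cubical h-polynomial is hˢᶜ(s , t) = f(2s , t - s). A k-cube has (k C j) 2ʲ faces of
-- codimension j, so counting the intervals [F , G] gives f_sd(a , b) = f(2a + b , b), hence
-- 2ᵐ hˢᶜ_sd(s , t) = hˢᶜ(3s + t , s + 3t): if hˢᶜ is palindromic, so is hˢᶜ_sd. The long h-vector
-- is symmetric iff hˢᶜ is palindromic and h_d = h_0, and h_d is determined by h_0 and the
-- alternating sum hˢᶜ(-1 , 1) = f(-2 , 2), which subdivision does not change.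
module Submission where

open import Defs
open import Data.Nat using (ℕ; zero; suc)
open import Data.Bool using (true)
open import Data.Fin.Subset using (Subset)
open import Data.Product using (_,_)
open import Relation.Binary.PropositionalEquality using (_≡_)

module FiniteSums where

  open import Data.Nat as ℕ using (ℕ; zero; suc; _∸_; _≤_; _<_; s≤s)
  import Data.Nat.Properties as ℕ
  open import Data.Nat.Combinatorics using (_C_)
  open import Data.Fin using (toℕ)
  open import Data.Integer using (ℤ; +_; -_; _+_; _*_; _-_; _^_; +-*-rawSemiring; ≢-nonZero)
  import Data.Integer.Properties as ℤ
  open import Data.Integer.Tactic.RingSolver using (solve-∀)
  import Algebra.Properties.CommutativeSemiring.Binomial as Binomial
  import Algebra.Properties.CommutativeSemiring.Exp as Exp
  import Algebra.Definitions.RawSemiring as RawSemiring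
  open import Data.Sum using (inj₁; inj₂)
  open import Function using (_∘_)
  open import Relation.Binary.PropositionalEquality
  open ≡-Reasoning

  ∑ : ℕ → (ℕ → ℤ) → ℤ
  ∑ zero    g = + 0
  ∑ (suc n) g = ∑ n g + g n

  ∑-cong : ∀ n {g h : ℕ → ℤ} → (∀ i → i < n → g i ≡ h i) → ∑ n g ≡ ∑ n h
  ∑-cong zero    eq = refl
  ∑-cong (suc n) eq = cong₂ _+_ (∑-cong n (λ i i<n → eq i (ℕ.m<n⇒m<1+n i<n))) (eq n ℕ.≤-refl)

  ∑-unfoldˡ : ∀ n (g : ℕ → ℤ) → ∑ (suc n) g ≡ g 0 + ∑ n (g ∘ suc)
  ∑-unfoldˡ zero    g = ℤ.+-comm (+ 0) (g 0)
  ∑-unfoldˡ (suc n) g = begin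
    ∑ (suc n) g + g (suc n)             ≡⟨ cong (_+ g (suc n)) (∑-unfoldˡ n g) ⟩
    g 0 + ∑ n (g ∘ suc) + g (suc n)     ≡⟨ ℤ.+-assoc (g 0) _ _ ⟩
    g 0 + (∑ n (g ∘ suc) + g (suc n))   ∎

  ∑-zero : ∀ n → ∑ n (λ _ → + 0) ≡ + 0
  ∑-zero zero    = refl
  ∑-zero (suc n) = cong (_+ + 0) (∑-zero n)

  ∑-distrib-+ : ∀ n (g h : ℕ → ℤ) → ∑ n (λ i → g i + h i) ≡ ∑ n g + ∑ n h
  ∑-distrib-+ zero    g h = refl
  ∑-distrib-+ (suc n) g h = begin
    ∑ n (λ i → g i + h i) + (g n + h n) ≡⟨ cong (_+ (g n + h n)) (∑-distrib-+ n g h) ⟩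
    ∑ n g + ∑ n h + (g n + h n)         ≡⟨ interchange (∑ n g) (∑ n h) (g n) (h n) ⟩
    ∑ n g + g n + (∑ n h + h n)         ∎
    where
    interchange : ∀ a b c e → a + b + (c + e) ≡ a + c + (b + e)
    interchange = solve-∀

  ∑-distrib-minus : ∀ n (g h : ℕ → ℤ) → ∑ n (λ i → g i - h i) ≡ ∑ n g - ∑ n h
  ∑-distrib-minus n g h = trans (∑-distrib-+ n g (-_ ∘ h)) (cong (λ z → ∑ n g + z) (∑-neg n))
    where
    ∑-neg : ∀ n → ∑ n (-_ ∘ h) ≡ - ∑ n h
    ∑-neg zero    = refl
    ∑-neg (suc n) = trans (cong (_+ - h n) (∑-neg n)) (sym (ℤ.neg-distrib-+ (∑ n h) (h n)))

  *-distribˡ-∑ : ∀ n a (g : ℕ → ℤ) → a * ∑ n g ≡ ∑ n (λ i → a * g i)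
  *-distribˡ-∑ zero    a g = ℤ.*-zeroʳ a
  *-distribˡ-∑ (suc n) a g = begin
    a * (∑ n g + g n)       ≡⟨ ℤ.*-distribˡ-+ a (∑ n g) (g n) ⟩
    a * ∑ n g + a * g n     ≡⟨ cong (_+ a * g n) (*-distribˡ-∑ n a g) ⟩
    ∑ n (λ i → a * g i) + a * g n ∎

  *-distribʳ-∑ : ∀ n a (g : ℕ → ℤ) → ∑ n g * a ≡ ∑ n (λ i → g i * a)
  *-distribʳ-∑ n a g = begin
    ∑ n g * a           ≡⟨ ℤ.*-comm (∑ n g) a ⟩
    a * ∑ n g           ≡⟨ *-distribˡ-∑ n a g ⟩
    ∑ n (λ i → a * g i) ≡⟨ ∑-cong n (λ i _ → ℤ.*-comm a (g i)) ⟩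
    ∑ n (λ i → g i * a) ∎

  ∑-comm : ∀ m n (g : ℕ → ℕ → ℤ) → ∑ m (λ i → ∑ n (g i)) ≡ ∑ n (λ j → ∑ m (λ i → g i j))
  ∑-comm zero    n g = sym (∑-zero n)
  ∑-comm (suc m) n g = begin
    ∑ m (λ i → ∑ n (g i)) + ∑ n (g m)            ≡⟨ cong (_+ ∑ n (g m)) (∑-comm m n g) ⟩
    ∑ n (λ j → ∑ m (λ i → g i j)) + ∑ n (g m)    ≡⟨ ∑-distrib-+ n _ _ ⟨
    ∑ n (λ j → ∑ m (λ i → g i j) + g m j)        ∎

  ∑-reverse : ∀ n (g : ℕ → ℤ) → ∑ n g ≡ ∑ n (λ i → g (n ∸ suc i))
  ∑-reverse zero    g = refl
  ∑-reverse (suc n) g = begin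
    ∑ n g + g n                          ≡⟨ ℤ.+-comm (∑ n g) (g n) ⟩
    g n + ∑ n g                          ≡⟨ cong (λ z → g n + z) (∑-reverse n g) ⟩
    g n + ∑ n (λ i → g (n ∸ suc i))      ≡⟨ ∑-unfoldˡ n (λ i → g (n ∸ i)) ⟨
    ∑ (suc n) (λ i → g (n ∸ i))          ∎

  ∑-truncate : ∀ {k} n (g : ℕ → ℤ) → k ≤ n → (∀ i → k ≤ i → g i ≡ + 0) → ∑ n g ≡ ∑ k g
  ∑-truncate n g k≤n vanish with ℕ.m≤n⇒m<n∨m≡n k≤n
  ... | inj₂ refl = refl
  ∑-truncate {k} (suc n) g _ vanish | inj₁ (s≤s k≤n) = begin
    ∑ n g + g n ≡⟨ cong₂ _+_ (∑-truncate n g k≤n vanish) (vanish n k≤n) ⟩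
    ∑ k g + + 0 ≡⟨ ℤ.+-identityʳ (∑ k g) ⟩
    ∑ k g       ∎

  private
    module ℤ-Semiring = RawSemiring +-*-rawSemiring

    ∑≡sum : ∀ n (g : ℕ → ℤ) → ∑ n g ≡ ℤ-Semiring.sum {n} (g ∘ toℕ)
    ∑≡sum zero    g = refl
    ∑≡sum (suc n) g = trans (∑-unfoldˡ n g) (cong (λ z → g 0 + z) (∑≡sum n (g ∘ suc)))

    ×≡* : ∀ n x → n ℤ-Semiring.× x ≡ + n * x
    ×≡* zero    x = sym (ℤ.*-zeroˡ x)
    ×≡* (suc n) x = begin
      x + n ℤ-Semiring.× x ≡⟨ cong (λ z → x + z) (×≡* n x) ⟩
      x + + n * x          ≡⟨ cong (_+ + n * x) (ℤ.*-identityˡ x) ⟨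
      + 1 * x + + n * x    ≡⟨ ℤ.*-distribʳ-+ x (+ 1) (+ n) ⟨
      + suc n * x          ∎

    ^≡^ : ∀ x n → x ℤ-Semiring.^ n ≡ x ^ n
    ^≡^ x zero    = refl
    ^≡^ x (suc n) = cong (x *_) (^≡^ x n)

  ^-distrib-* : ∀ x y n → (x * y) ^ n ≡ x ^ n * y ^ n
  ^-distrib-* x y n = begin
    (x * y) ^ n                           ≡⟨ ^≡^ (x * y) n ⟨
    (x * y) ℤ-Semiring.^ n                ≡⟨ Exp.^-distrib-* ℤ.+-*-commutativeSemiring x y n ⟩
    x ℤ-Semiring.^ n * y ℤ-Semiring.^ n   ≡⟨ cong₂ _*_ (^≡^ x n) (^≡^ y n) ⟩
    x ^ n * y ^ n                         ∎

  binomial-theorem : ∀ n x y → (x + y) ^ n ≡ ∑ (suc n) (λ k → + (n C k) * (x ^ k * y ^ (n ∸ k)))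
  binomial-theorem n x y = begin
    (x + y) ^ n                                     ≡⟨ ^≡^ (x + y) n ⟨
    (x + y) ℤ-Semiring.^ n                          ≡⟨ Binomial.theorem ℤ.+-*-commutativeSemiring n x y ⟩
    ℤ-Semiring.sum {suc n} (term ∘ toℕ)             ≡⟨ ∑≡sum (suc n) term ⟨
    ∑ (suc n) term                                  ≡⟨ ∑-cong (suc n) (λ k _ → term≡ k) ⟩
    ∑ (suc n) (λ k → + (n C k) * (x ^ k * y ^ (n ∸ k))) ∎
    where
    term : ℕ → ℤ
    term k = (n C k) ℤ-Semiring.× (x ℤ-Semiring.^ k * y ℤ-Semiring.^ (n ∸ k))
    term≡ : ∀ k → term k ≡ + (n C k) * (x ^ k * y ^ (n ∸ k))
    term≡ k = trans (×≡* (n C k) _) (cong₂ (λ u v → + (n C k) * (u * v)) (^≡^ x k) (^≡^ y (n ∸ k)))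

  *-cancelˡ-^ : ∀ i n {x y} → i ≢ + 0 → i ^ n * x ≡ i ^ n * y → x ≡ y
  *-cancelˡ-^ i n {x} {y} i≢0 = ℤ.*-cancelˡ-≡ (i ^ n) x y {{≢-nonZero (i≢0 ∘ ℤ.i^n≡0⇒i≡0 i n)}}

  pos-^ : ∀ a n → + (a ℕ.^ n) ≡ (+ a) ^ n
  pos-^ a zero    = refl
  pos-^ a (suc n) = trans (ℤ.pos-* a (a ℕ.^ n)) (cong (+ a *_) (pos-^ a n))

  ∑ℕ : ℕ → (ℕ → ℕ) → ℕ
  ∑ℕ zero    g = 0
  ∑ℕ (suc n) g = ∑ℕ n g ℕ.+ g n

  ∑ℕ-cong : ∀ n {g h : ℕ → ℕ} → (∀ i → g i ≡ h i) → ∑ℕ n g ≡ ∑ℕ n h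
  ∑ℕ-cong zero    eq = refl
  ∑ℕ-cong (suc n) eq = cong₂ ℕ._+_ (∑ℕ-cong n eq) (eq n)

  pos-∑ℕ : ∀ n g → + ∑ℕ n g ≡ ∑ n (+_ ∘ g)
  pos-∑ℕ zero    g = refl
  pos-∑ℕ (suc n) g = trans (ℤ.pos-+ (∑ℕ n g) (g n)) (cong (_+ + g n) (pos-∑ℕ n g))

module BinaryForms where

  open FiniteSums
  open import Data.Nat as ℕ using (ℕ; zero; suc; _∸_; _≤_; _<_; z≤n; s≤s)
  import Data.Nat.Properties as ℕ
  open import Data.Integer using (ℤ; +_; -_; _+_; _*_; _-_; _^_)
  import Data.Integer.Properties as ℤ
  open import Data.Integer.Tactic.RingSolver using (solve-∀)
  open import Data.List using ([]; _∷_; length)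
  open import Function using (_∘_)
  open import Relation.Binary.PropositionalEquality
  open ≡-Reasoning

  -- The degree-m homogenisation ∑ᵢ pᵢ sⁱ tᵐ⁻ⁱ of p at (s , t); meaningful only when length p ≤ suc m.
  homog : Poly → ℕ → ℤ → ℤ → ℤ
  homog []      m s t = + 0
  homog (a ∷ p) m s t = a * t ^ m + s * homog p (m ∸ 1) s t

  length-+P : ∀ p q {n} → length p ≤ n → length q ≤ n → length (p +P q) ≤ n
  length-+P []      q       lp       lq       = lq
  length-+P (a ∷ p) []      lp       lq       = lp
  length-+P (a ∷ p) (b ∷ q) (s≤s lp) (s≤s lq) = s≤s (length-+P p q lp lq)

  length-scale : ∀ a p → length (scale a p) ≡ length p
  length-scale a []      = refl
  length-scale a (b ∷ p) = cong suc (length-scale a p)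

  length-*P : ∀ p q {m₁ m₂} → length p ≤ suc m₁ → length q ≤ suc m₂ → length (p *P q) ≤ suc (m₁ ℕ.+ m₂)
  length-*P []          q                 lp       lq = z≤n
  length-*P (a ∷ [])    q {zero}  {m₂}    lp       lq =
    length-+P (scale a q) (+ 0 ∷ []) (subst (_≤ suc m₂) (sym (length-scale a q)) lq) (s≤s z≤n)
  length-*P (a ∷ p)     q {suc m₁} {m₂}   (s≤s lp) lq =
    length-+P (scale a q) (+ 0 ∷ (p *P q))
      (subst (_≤ suc (suc m₁ ℕ.+ m₂)) (sym (length-scale a q)) (ℕ.≤-trans lq (s≤s (ℕ.m≤n+m m₂ (suc m₁)))))
      (s≤s (length-*P p q lp lq))

  length-^P : ∀ p k → length p ≤ 2 → length (p ^P k) ≤ suc k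
  length-^P p zero    lp = ℕ.≤-refl
  length-^P p (suc k) lp = length-*P p (p ^P k) lp (length-^P p k lp)

  length-sumP : ∀ k P {n} → (∀ j → j < k → length (P j) ≤ n) → length (sumP k P) ≤ n
  length-sumP zero    P h = z≤n
  length-sumP (suc k) P h =
    length-+P (sumP k P) (P k) (length-sumP k P (λ j j<k → h j (ℕ.m<n⇒m<1+n j<k))) (h k ℕ.≤-refl)

  homog-+P : ∀ p q m s t → homog (p +P q) m s t ≡ homog p m s t + homog q m s t
  homog-+P []      q       m s t = sym (ℤ.+-identityˡ _)
  homog-+P (a ∷ p) []      m s t = sym (ℤ.+-identityʳ _)
  homog-+P (a ∷ p) (b ∷ q) m s t = begin
    (a + b) * t ^ m + s * homog (p +P q) (m ∸ 1) s t
      ≡⟨ cong (λ x → (a + b) * t ^ m + s * x) (homog-+P p q (m ∸ 1) s t) ⟩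
    (a + b) * t ^ m + s * (homog p (m ∸ 1) s t + homog q (m ∸ 1) s t)
      ≡⟨ rearrange a b (t ^ m) s _ _ ⟩
    a * t ^ m + s * homog p (m ∸ 1) s t + (b * t ^ m + s * homog q (m ∸ 1) s t) ∎
    where
    rearrange : ∀ a b T s x y → (a + b) * T + s * (x + y) ≡ a * T + s * x + (b * T + s * y)
    rearrange = solve-∀

  homog-scale : ∀ a p m s t → homog (scale a p) m s t ≡ a * homog p m s t
  homog-scale a []      m s t = sym (ℤ.*-zeroʳ a)
  homog-scale a (b ∷ p) m s t = begin
    a * b * t ^ m + s * homog (scale a p) (m ∸ 1) s t
      ≡⟨ cong (λ x → a * b * t ^ m + s * x) (homog-scale a p (m ∸ 1) s t) ⟩
    a * b * t ^ m + s * (a * homog p (m ∸ 1) s t) ≡⟨ rearrange a b (t ^ m) s _ ⟩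
    a * (b * t ^ m + s * homog p (m ∸ 1) s t) ∎
    where
    rearrange : ∀ a b T s x → a * b * T + s * (a * x) ≡ a * (b * T + s * x)
    rearrange = solve-∀

  homog-raise : ∀ q k m s t → length q ≤ suc m → homog q (k ℕ.+ m) s t ≡ t ^ k * homog q m s t
  homog-raise []           k m       s t _       = sym (ℤ.*-zeroʳ (t ^ k))
  homog-raise (b ∷ [])     k zero    s t _       = begin
    b * t ^ (k ℕ.+ 0) + s * + 0 ≡⟨ cong (λ x → b * t ^ x + s * + 0) (ℕ.+-identityʳ k) ⟩
    b * t ^ k + s * + 0         ≡⟨ rearrange b (t ^ k) s ⟩
    t ^ k * (b * t ^ 0 + s * + 0) ∎
    where
    rearrange : ∀ b T s → b * T + s * + 0 ≡ T * (b * + 1 + s * + 0)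
    rearrange = solve-∀
  homog-raise (b ∷ q)      k (suc m) s t (s≤s l) = begin
    b * t ^ (k ℕ.+ suc m) + s * homog q (k ℕ.+ suc m ∸ 1) s t
      ≡⟨ cong (λ y → b * t ^ (k ℕ.+ suc m) + s * homog q (y ∸ 1) s t) (ℕ.+-suc k m) ⟩
    b * t ^ (k ℕ.+ suc m) + s * homog q (k ℕ.+ m) s t
      ≡⟨ cong₂ (λ x y → b * x + s * y) (ℤ.^-distribˡ-+-* t k (suc m)) (homog-raise q k m s t l) ⟩
    b * (t ^ k * t ^ suc m) + s * (t ^ k * homog q m s t) ≡⟨ rearrange b (t ^ k) (t ^ suc m) s _ ⟩
    t ^ k * (b * t ^ suc m + s * homog q m s t) ∎
    where
    rearrange : ∀ b K T s x → b * (K * T) + s * (K * x) ≡ K * (b * T + s * x)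
    rearrange = solve-∀

  homog-*P : ∀ p q m₁ m₂ s t → length p ≤ suc m₁ → length q ≤ suc m₂ →
             homog (p *P q) (m₁ ℕ.+ m₂) s t ≡ homog p m₁ s t * homog q m₂ s t
  homog-*P []       q m₁       m₂ s t lp       lq = refl
  homog-*P (a ∷ []) q zero     m₂ s t lp       lq = begin
    homog (scale a q +P (+ 0 ∷ [])) m₂ s t               ≡⟨ homog-+P (scale a q) _ m₂ s t ⟩
    homog (scale a q) m₂ s t + (+ 0 * t ^ m₂ + s * + 0)  ≡⟨ cong (_+ (+ 0 * t ^ m₂ + s * + 0)) (homog-scale a q m₂ s t) ⟩
    a * homog q m₂ s t + (+ 0 * t ^ m₂ + s * + 0)       ≡⟨ rearrange a _ (t ^ m₂) s ⟩
    (a * + 1 + s * + 0) * homog q m₂ s t                ∎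
    where
    rearrange : ∀ a h T s → a * h + (+ 0 * T + s * + 0) ≡ (a * + 1 + s * + 0) * h
    rearrange = solve-∀
  homog-*P (a ∷ p)  q (suc m₁) m₂ s t (s≤s lp) lq = begin
    homog (scale a q +P (+ 0 ∷ (p *P q))) (suc m₁ ℕ.+ m₂) s t
      ≡⟨ homog-+P (scale a q) _ _ s t ⟩
    homog (scale a q) (suc m₁ ℕ.+ m₂) s t + (+ 0 * T + s * homog (p *P q) (m₁ ℕ.+ m₂) s t)
      ≡⟨ cong₂ (λ x y → x + (+ 0 * T + s * y)) (homog-scale a q _ s t) (homog-*P p q m₁ m₂ s t lp lq) ⟩
    a * homog q (suc m₁ ℕ.+ m₂) s t + (+ 0 * T + s * (homog p m₁ s t * homog q m₂ s t))
      ≡⟨ cong (λ x → a * x + (+ 0 * T + s * (homog p m₁ s t * homog q m₂ s t))) (homog-raise q (suc m₁) m₂ s t lq) ⟩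
    a * (t ^ suc m₁ * homog q m₂ s t) + (+ 0 * T + s * (homog p m₁ s t * homog q m₂ s t))
      ≡⟨ rearrange a (t ^ suc m₁) (homog q m₂ s t) T s (homog p m₁ s t) ⟩
    (a * t ^ suc m₁ + s * homog p m₁ s t) * homog q m₂ s t ∎
    where
    T : ℤ
    T = t ^ (suc m₁ ℕ.+ m₂)
    rearrange : ∀ a T h U s x → a * (T * h) + (+ 0 * U + s * (x * h)) ≡ (a * T + s * x) * h
    rearrange = solve-∀

  homog-^P : ∀ p k s t → length p ≤ 2 → homog (p ^P k) k s t ≡ homog p 1 s t ^ k
  homog-^P p zero    s t lp = one s
    where
    one : ∀ s → + 1 * + 1 + s * + 0 ≡ + 1
    one = solve-∀
  homog-^P p (suc k) s t lp = begin
    homog (p *P (p ^P k)) (1 ℕ.+ k) s t      ≡⟨ homog-*P p (p ^P k) 1 k s t lp (length-^P p k lp) ⟩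
    homog p 1 s t * homog (p ^P k) k s t     ≡⟨ cong (homog p 1 s t *_) (homog-^P p k s t lp) ⟩
    homog p 1 s t * homog p 1 s t ^ k        ∎

  homog-sumP : ∀ k P m s t → homog (sumP k P) m s t ≡ ∑ k (λ j → homog (P j) m s t)
  homog-sumP zero    P m s t = refl
  homog-sumP (suc k) P m s t =
    trans (homog-+P (sumP k P) (P k) m s t) (cong (_+ homog (P k) m s t) (homog-sumP k P m s t))

  form : ℕ → (ℕ → ℤ) → ℤ → ℤ → ℤ
  form m c s t = ∑ (suc m) (λ i → c i * (s ^ i * t ^ (m ∸ i)))

  homog≡form : ∀ p m s t → length p ≤ suc m → homog p m s t ≡ form m (coeff p) s t
  homog≡form []            m       s t lp       =
    sym (trans (∑-cong (suc m) (λ i _ → ℤ.*-zeroˡ (s ^ i * t ^ (m ∸ i)))) (∑-zero (suc m)))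
  homog≡form (a ∷ [])      zero    s t lp       = rearrange a s (t ^ 0)
    where
    rearrange : ∀ a s T → a * T + s * + 0 ≡ + 0 + a * (+ 1 * T)
    rearrange = solve-∀
  homog≡form (a ∷ p)       (suc m) s t (s≤s lp) = begin
    a * t ^ suc m + s * homog p m s t
      ≡⟨ cong (λ x → a * t ^ suc m + s * x) (homog≡form p m s t lp) ⟩
    a * t ^ suc m + s * ∑ (suc m) (λ i → coeff p i * (s ^ i * t ^ (m ∸ i)))
      ≡⟨ cong (λ x → a * t ^ suc m + x) (*-distribˡ-∑ (suc m) s _) ⟩
    a * t ^ suc m + ∑ (suc m) (λ i → s * (coeff p i * (s ^ i * t ^ (m ∸ i))))
      ≡⟨ cong₂ _+_ (head a (t ^ suc m)) (∑-cong (suc m) (λ i _ → shift s (coeff p i) (s ^ i) (t ^ (m ∸ i)))) ⟩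
    g 0 + ∑ (suc m) (λ i → g (suc i))
      ≡⟨ ∑-unfoldˡ (suc m) g ⟨
    ∑ (suc (suc m)) g ∎
    where
    g : ℕ → ℤ
    g i = coeff (a ∷ p) i * (s ^ i * t ^ (suc m ∸ i))
    head : ∀ a T → a * T ≡ a * (+ 1 * T)
    head = solve-∀
    shift : ∀ s c S T → s * (c * (S * T)) ≡ c * ((s * S) * T)
    shift = solve-∀

  module _ (m : ℕ) (f : ℕ → ℕ) where

    private
      2x 1-x : Poly
      2x  = + 0 ∷ + 2 ∷ []
      1-x = + 1 ∷ - (+ 1) ∷ []

      summand : ℕ → Poly
      summand j = (2x ^P j) *P (1-x ^P (m ∸ j))

      length-summand : ∀ j → j ≤ m → length (summand j) ≤ suc m
      length-summand j j≤m = subst (λ k → length (summand j) ≤ suc k) (ℕ.m+[n∸m]≡n j≤m)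
        (length-*P (2x ^P j) (1-x ^P (m ∸ j)) (length-^P 2x j ℕ.≤-refl) (length-^P 1-x (m ∸ j) ℕ.≤-refl))

      homog-summand : ∀ j s t → j ≤ m → homog (summand j) m s t ≡ (+ 2 * s) ^ j * (t - s) ^ (m ∸ j)
      homog-summand j s t j≤m = begin
        homog (summand j) m s t
          ≡⟨ cong (λ k → homog (summand j) k s t) (ℕ.m+[n∸m]≡n j≤m) ⟨
        homog (summand j) (j ℕ.+ (m ∸ j)) s t
          ≡⟨ homog-*P (2x ^P j) (1-x ^P (m ∸ j)) j (m ∸ j) s t (length-^P 2x j ℕ.≤-refl) (length-^P 1-x (m ∸ j) ℕ.≤-refl) ⟩
        homog (2x ^P j) j s t * homog (1-x ^P (m ∸ j)) (m ∸ j) s t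
          ≡⟨ cong₂ _*_ (homog-^P 2x j s t ℕ.≤-refl) (homog-^P 1-x (m ∸ j) s t ℕ.≤-refl) ⟩
        homog 2x 1 s t ^ j * homog 1-x 1 s t ^ (m ∸ j)
          ≡⟨ cong₂ (λ a b → a ^ j * b ^ (m ∸ j)) (homog-2x s t) (homog-1-x s t) ⟩
        (+ 2 * s) ^ j * (t - s) ^ (m ∸ j) ∎
        where
        homog-2x : ∀ s t → + 0 * (t * + 1) + s * (+ 2 * + 1 + s * + 0) ≡ + 2 * s
        homog-2x = solve-∀
        homog-1-x : ∀ s t → + 1 * (t * + 1) + s * (- (+ 1) * + 1 + s * + 0) ≡ t - s
        homog-1-x = solve-∀

    length-shortPoly : length (shortPoly (suc m) f) ≤ suc m
    length-shortPoly = length-sumP (suc m) _ (λ j j<sm →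
      subst (_≤ suc m) (sym (length-scale (+ f j) (summand j))) (length-summand j (ℕ.≤-pred j<sm)))

    homog-shortPoly : ∀ s t → homog (shortPoly (suc m) f) m s t ≡ form m (+_ ∘ f) (+ 2 * s) (t - s)
    homog-shortPoly s t = trans (homog-sumP (suc m) _ m s t) (∑-cong (suc m) (λ j j<sm → begin
      homog (scale (+ f j) (summand j)) m s t ≡⟨ homog-scale (+ f j) (summand j) m s t ⟩
      + f j * homog (summand j) m s t         ≡⟨ cong (+ f j *_) (homog-summand j s t (ℕ.≤-pred j<sm)) ⟩
      + f j * ((+ 2 * s) ^ j * (t - s) ^ (m ∸ j)) ∎))

  form-homogeneous : ∀ m c a b → form m c (+ 2 * a) (+ 2 * b) ≡ (+ 2) ^ m * form m c a b
  form-homogeneous m c a b = begin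
    form m c (+ 2 * a) (+ 2 * b)                              ≡⟨ ∑-cong (suc m) (λ j j<sm → term j (ℕ.≤-pred j<sm)) ⟩
    ∑ (suc m) (λ j → (+ 2) ^ m * (c j * (a ^ j * b ^ (m ∸ j)))) ≡⟨ *-distribˡ-∑ (suc m) ((+ 2) ^ m) _ ⟨
    (+ 2) ^ m * form m c a b                                  ∎
    where
    rearrange : ∀ C T A U B → C * (T * A * (U * B)) ≡ T * U * (C * (A * B))
    rearrange = solve-∀
    term : ∀ j → j ≤ m → c j * ((+ 2 * a) ^ j * (+ 2 * b) ^ (m ∸ j)) ≡ (+ 2) ^ m * (c j * (a ^ j * b ^ (m ∸ j)))
    term j j≤m = begin
      c j * ((+ 2 * a) ^ j * (+ 2 * b) ^ (m ∸ j))
        ≡⟨ cong₂ (λ x y → c j * (x * y)) (^-distrib-* (+ 2) a j) (^-distrib-* (+ 2) b (m ∸ j)) ⟩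
      c j * ((+ 2) ^ j * a ^ j * ((+ 2) ^ (m ∸ j) * b ^ (m ∸ j)))
        ≡⟨ rearrange (c j) ((+ 2) ^ j) (a ^ j) ((+ 2) ^ (m ∸ j)) (b ^ (m ∸ j)) ⟩
      (+ 2) ^ j * (+ 2) ^ (m ∸ j) * (c j * (a ^ j * b ^ (m ∸ j)))
        ≡⟨ cong (_* (c j * (a ^ j * b ^ (m ∸ j)))) (ℤ.^-distribˡ-+-* (+ 2) j (m ∸ j)) ⟨
      (+ 2) ^ (j ℕ.+ (m ∸ j)) * (c j * (a ^ j * b ^ (m ∸ j)))
        ≡⟨ cong (λ k → (+ 2) ^ k * (c j * (a ^ j * b ^ (m ∸ j)))) (ℕ.m+[n∸m]≡n j≤m) ⟩
      (+ 2) ^ m * (c j * (a ^ j * b ^ (m ∸ j))) ∎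

module PolynomialIdentity where

  open FiniteSums
  open import Data.Nat as ℕ using (ℕ; zero; suc; _≤_; _<_; s≤s)
  import Data.Nat.Properties as ℕ
  open import Data.Integer using (ℤ; +_; _+_; _*_; _-_; _^_; ∣_∣)
  import Data.Integer.Properties as ℤ
  open import Data.Integer.Tactic.RingSolver using (solve-∀)
  open import Data.List using ([]; _∷_; length)
  open import Data.List.Relation.Unary.All using (All; []; _∷_)
  open import Data.Sum using (inj₁; inj₂)
  open import Function using (_∘_)
  open import Relation.Nullary using (contradiction)
  open import Relation.Binary.PropositionalEquality
  open ≡-Reasoning

  eval : Poly → ℤ → ℤ
  eval []      s = + 0
  eval (a ∷ p) s = a + s * eval p s

  -- deflate r p is the quotient of (a ∷ p) by (x - r), for any constant term a.
  deflate : ℤ → Poly → Poly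
  deflate r []      = []
  deflate r (b ∷ p) = eval (b ∷ p) r ∷ deflate r p

  length-deflate : ∀ r p → length (deflate r p) ≡ length p
  length-deflate r []      = refl
  length-deflate r (b ∷ p) = cong suc (length-deflate r p)

  eval-deflate : ∀ a p r s → eval (a ∷ p) s ≡ eval (a ∷ p) r + (s - r) * eval (deflate r p) s
  eval-deflate a []      r s = rearrange a r s
    where
    rearrange : ∀ a r s → a + s * + 0 ≡ a + r * + 0 + (s - r) * + 0
    rearrange = solve-∀
  eval-deflate a (b ∷ p) r s = begin
    a + s * eval (b ∷ p) s
      ≡⟨ cong (λ x → a + s * x) (eval-deflate b p r s) ⟩
    a + s * (eval (b ∷ p) r + (s - r) * eval (deflate r p) s)
      ≡⟨ rearrange a s r (eval (b ∷ p) r) (eval (deflate r p) s) ⟩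
    a + r * eval (b ∷ p) r + (s - r) * (eval (b ∷ p) r + s * eval (deflate r p) s) ∎
    where
    rearrange : ∀ a s r E Q → a + s * (E + (s - r) * Q) ≡ (a + r * E) + (s - r) * (E + s * Q)
    rearrange = solve-∀

  IsZero : Poly → Set
  IsZero = All (_≡ + 0)

  isZero-deflate : ∀ a p r → IsZero (deflate r p) → eval (a ∷ p) r ≡ + 0 → IsZero (a ∷ p)
  isZero-deflate a []      r z         root = trans (sym (ℤ.+-identityʳ a)) (trans (cong (_+_ a) (sym (ℤ.*-zeroʳ r))) root) ∷ []
  isZero-deflate a (b ∷ p) r (rb ∷ z) root = a≡0 ∷ isZero-deflate b p r z rb
    where
    cancel : ∀ a r E → a ≡ a + r * E - r * E
    cancel = solve-∀
    a≡0 : a ≡ + 0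
    a≡0 = begin
      a                                          ≡⟨ cancel a r (eval (b ∷ p) r) ⟩
      a + r * eval (b ∷ p) r - r * eval (b ∷ p) r ≡⟨ cong₂ (λ x y → x - r * y) root rb ⟩
      + 0 - r * + 0                              ≡⟨ cong (+ 0 -_) (ℤ.*-zeroʳ r) ⟩
      + 0                                        ∎

  -- p = (x - r) q + p(r) with r = B + 1: then p(r) = 0 and q vanishes beyond B + 1.
  vanishing⇒isZero : ∀ {N} p B → length p ≤ N → (∀ s → B < ∣ s ∣ → eval p s ≡ + 0) → IsZero p
  vanishing⇒isZero []      B _ vanish = []
  vanishing⇒isZero {suc N} (a ∷ p) B (s≤s |p|≤N) vanish =
    isZero-deflate a p r
      (vanishing⇒isZero (deflate r p) (suc B) (subst (_≤ N) (sym (length-deflate r p)) |p|≤N) quotient-vanishes)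
      (vanish r ℕ.≤-refl)
    where
    r : ℤ
    r = + suc B
    quotient-vanishes : ∀ s → suc B < ∣ s ∣ → eval (deflate r p) s ≡ + 0
    quotient-vanishes s B+1<s with ℤ.i*j≡0⇒i≡0∨j≡0 (s - r) product≡0
      where
      product≡0 : (s - r) * eval (deflate r p) s ≡ + 0
      product≡0 = begin
        (s - r) * eval (deflate r p) s                 ≡⟨ ℤ.+-identityˡ _ ⟨
        + 0 + (s - r) * eval (deflate r p) s           ≡⟨ cong (_+ (s - r) * eval (deflate r p) s) (vanish r ℕ.≤-refl) ⟨
        eval (a ∷ p) r + (s - r) * eval (deflate r p) s ≡⟨ eval-deflate a p r s ⟨
        eval (a ∷ p) s                                 ≡⟨ vanish s (ℕ.<-trans (ℕ.n<1+n B) B+1<s) ⟩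
        + 0                                            ∎
    ... | inj₂ q≡0   = q≡0
    ... | inj₁ s-r≡0 = contradiction (cong ∣_∣ (sym (ℤ.i-j≡0⇒i≡j s r s-r≡0))) (ℕ.<⇒≢ B+1<s)

  coefficients : ℕ → (ℕ → ℤ) → Poly
  coefficients zero    g = []
  coefficients (suc n) g = g 0 ∷ coefficients n (g ∘ suc)

  eval-coefficients : ∀ n g s → eval (coefficients n g) s ≡ ∑ n (λ i → g i * s ^ i)
  eval-coefficients zero    g s = refl
  eval-coefficients (suc n) g s = begin
    g 0 + s * eval (coefficients n (g ∘ suc)) s       ≡⟨ cong (λ x → g 0 + s * x) (eval-coefficients n (g ∘ suc) s) ⟩
    g 0 + s * ∑ n (λ i → g (suc i) * s ^ i)           ≡⟨ cong (_+_ (g 0)) (*-distribˡ-∑ n s _) ⟩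
    g 0 + ∑ n (λ i → s * (g (suc i) * s ^ i))         ≡⟨ cong₂ _+_ (ℤ.*-identityʳ (g 0)) (∑-cong n (λ i _ → rearrange s (g (suc i)) (s ^ i))) ⟨
    g 0 * s ^ 0 + ∑ n (λ i → g (suc i) * s ^ suc i)   ≡⟨ ∑-unfoldˡ n (λ i → g i * s ^ i) ⟨
    ∑ (suc n) (λ i → g i * s ^ i)                     ∎
    where
    rearrange : ∀ s c S → c * (s * S) ≡ s * (c * S)
    rearrange = solve-∀

  isZero-coefficients : ∀ n g → IsZero (coefficients n g) → ∀ i → i < n → g i ≡ + 0
  isZero-coefficients (suc n) g (g0≡0 ∷ z) zero    _         = g0≡0
  isZero-coefficients (suc n) g (g0≡0 ∷ z) (suc i) (s≤s i<n) = isZero-coefficients n (g ∘ suc) z i i<n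

  vanishing-polynomial⇒zero-coefficients : ∀ n g → (∀ s → ∑ n (λ i → g i * s ^ i) ≡ + 0) → ∀ i → i < n → g i ≡ + 0
  vanishing-polynomial⇒zero-coefficients n g vanish = isZero-coefficients n g
    (vanishing⇒isZero (coefficients n g) 0 ℕ.≤-refl (λ s _ → trans (eval-coefficients n g s) (vanish s)))

module SdFVector where

  open FiniteSums
  open BinaryForms
  open import Data.Nat as ℕ using (ℕ; suc; _∸_; _≤_; s≤s)
  import Data.Nat.Properties as ℕ
  open import Data.Nat.Combinatorics using (_C_; k>n⇒nCk≡0)
  open import Data.Integer using (ℤ; +_; _+_; _*_; _^_)
  import Data.Integer.Properties as ℤ
  open import Data.Integer.Tactic.RingSolver using (solve-∀)
  open import Function using (_∘_)
  open import Relation.Nullary using (yes; no)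
  open import Relation.Binary.PropositionalEquality
  open ≡-Reasoning

  -- f_j(sd_c K) in terms of f(K): a k-face contains (k C j) 2ʲ faces of codimension j.
  sd-fvector : ℕ → (ℕ → ℕ) → ℕ → ℕ
  sd-fvector d f j = ∑ℕ d (λ k → (k C j) ℕ.* 2 ℕ.^ j ℕ.* f k)

  binomial-padded : ∀ {k} m x b → k ≤ m → ∑ (suc m) (λ j → + (k C j) * (x ^ j * b ^ (m ∸ j))) ≡ (x + b) ^ k * b ^ (m ∸ k)
  binomial-padded {k} m x b k≤m = begin
    ∑ (suc m) (λ j → + (k C j) * (x ^ j * b ^ (m ∸ j)))               ≡⟨ ∑-cong (suc m) (λ j _ → split j) ⟩
    ∑ (suc m) (λ j → + (k C j) * (x ^ j * b ^ (k ∸ j)) * b ^ (m ∸ k)) ≡⟨ *-distribʳ-∑ (suc m) (b ^ (m ∸ k)) _ ⟨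
    ∑ (suc m) term * b ^ (m ∸ k)                                       ≡⟨ cong (_* b ^ (m ∸ k)) (∑-truncate (suc m) term (s≤s k≤m) beyond-k) ⟩
    ∑ (suc k) term * b ^ (m ∸ k)                                       ≡⟨ cong (_* b ^ (m ∸ k)) (binomial-theorem k x b) ⟨
    (x + b) ^ k * b ^ (m ∸ k)                                          ∎
    where
    term : ℕ → ℤ
    term j = + (k C j) * (x ^ j * b ^ (k ∸ j))
    beyond-k : ∀ j → suc k ≤ j → term j ≡ + 0
    beyond-k j k<j rewrite k>n⇒nCk≡0 k<j = ℤ.*-zeroˡ (x ^ j * b ^ (k ∸ j))
    rearrange : ∀ B X P Q → B * (X * (P * Q)) ≡ B * (X * P) * Q
    rearrange = solve-∀
    split : ∀ j → + (k C j) * (x ^ j * b ^ (m ∸ j)) ≡ term j * b ^ (m ∸ k)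
    split j with j ℕ.≤? k
    ... | yes j≤k = begin
      + (k C j) * (x ^ j * b ^ (m ∸ j))                   ≡⟨ cong (λ e → + (k C j) * (x ^ j * b ^ e)) (∸-split j≤k) ⟩
      + (k C j) * (x ^ j * b ^ ((k ∸ j) ℕ.+ (m ∸ k)))     ≡⟨ cong (λ z → + (k C j) * (x ^ j * z)) (ℤ.^-distribˡ-+-* b (k ∸ j) (m ∸ k)) ⟩
      + (k C j) * (x ^ j * (b ^ (k ∸ j) * b ^ (m ∸ k)))   ≡⟨ rearrange (+ (k C j)) (x ^ j) (b ^ (k ∸ j)) (b ^ (m ∸ k)) ⟩
      term j * b ^ (m ∸ k)                                 ∎
      where
      ∸-split : j ≤ k → m ∸ j ≡ (k ∸ j) ℕ.+ (m ∸ k)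
      ∸-split j≤k = begin
        m ∸ j                 ≡⟨ cong (_∸ j) (ℕ.m∸n+n≡m k≤m) ⟨
        (m ∸ k) ℕ.+ k ∸ j     ≡⟨ ℕ.+-∸-assoc (m ∸ k) j≤k ⟩
        (m ∸ k) ℕ.+ (k ∸ j)   ≡⟨ ℕ.+-comm (m ∸ k) (k ∸ j) ⟩
        (k ∸ j) ℕ.+ (m ∸ k)   ∎
    ... | no j≰k rewrite k>n⇒nCk≡0 (ℕ.≰⇒> j≰k) = begin
      + 0 * (x ^ j * b ^ (m ∸ j))               ≡⟨ ℤ.*-zeroˡ (x ^ j * b ^ (m ∸ j)) ⟩
      + 0                                       ≡⟨ ℤ.*-zeroˡ (b ^ (m ∸ k)) ⟨
      + 0 * b ^ (m ∸ k)                         ≡⟨ cong (_* b ^ (m ∸ k)) (ℤ.*-zeroˡ (x ^ j * b ^ (k ∸ j))) ⟨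
      + 0 * (x ^ j * b ^ (k ∸ j)) * b ^ (m ∸ k) ∎

  form-sd : ∀ m f g → (∀ j → g j ≡ sd-fvector (suc m) f j) →
            ∀ a b → form m (+_ ∘ g) a b ≡ form m (+_ ∘ f) (+ 2 * a + b) b
  form-sd m f g g≡ a b = begin
    ∑ (suc m) (λ j → + g j * (a ^ j * b ^ (m ∸ j)))
      ≡⟨ ∑-cong (suc m) (λ j _ → expand j) ⟩
    ∑ (suc m) (λ j → ∑ (suc m) (λ k → + f k * (+ (k C j) * ((+ 2 * a) ^ j * b ^ (m ∸ j)))))
      ≡⟨ ∑-comm (suc m) (suc m) _ ⟩
    ∑ (suc m) (λ k → ∑ (suc m) (λ j → + f k * (+ (k C j) * ((+ 2 * a) ^ j * b ^ (m ∸ j)))))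
      ≡⟨ ∑-cong (suc m) (λ k k<sm → trans (sym (*-distribˡ-∑ (suc m) (+ f k) _))
                                          (cong (+ f k *_) (binomial-padded m (+ 2 * a) b (ℕ.≤-pred k<sm)))) ⟩
    ∑ (suc m) (λ k → + f k * ((+ 2 * a + b) ^ k * b ^ (m ∸ k))) ∎
    where
    rearrange : ∀ B T F A Q → B * T * F * (A * Q) ≡ F * (B * (T * A * Q))
    rearrange = solve-∀
    coefficient : ∀ j k → + ((k C j) ℕ.* 2 ℕ.^ j ℕ.* f k) * (a ^ j * b ^ (m ∸ j)) ≡ + f k * (+ (k C j) * ((+ 2 * a) ^ j * b ^ (m ∸ j)))
    coefficient j k = begin
      + ((k C j) ℕ.* 2 ℕ.^ j ℕ.* f k) * (a ^ j * b ^ (m ∸ j))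
        ≡⟨ cong (_* (a ^ j * b ^ (m ∸ j))) (ℤ.pos-* ((k C j) ℕ.* 2 ℕ.^ j) (f k)) ⟩
      + ((k C j) ℕ.* 2 ℕ.^ j) * + f k * (a ^ j * b ^ (m ∸ j))
        ≡⟨ cong (λ z → z * + f k * (a ^ j * b ^ (m ∸ j))) (trans (ℤ.pos-* (k C j) (2 ℕ.^ j)) (cong (+ (k C j) *_) (pos-^ 2 j))) ⟩
      + (k C j) * (+ 2) ^ j * + f k * (a ^ j * b ^ (m ∸ j))
        ≡⟨ rearrange (+ (k C j)) ((+ 2) ^ j) (+ f k) (a ^ j) (b ^ (m ∸ j)) ⟩
      + f k * (+ (k C j) * ((+ 2) ^ j * a ^ j * b ^ (m ∸ j)))
        ≡⟨ cong (λ z → + f k * (+ (k C j) * (z * b ^ (m ∸ j)))) (^-distrib-* (+ 2) a j) ⟨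
      + f k * (+ (k C j) * ((+ 2 * a) ^ j * b ^ (m ∸ j))) ∎
    expand : ∀ j → + g j * (a ^ j * b ^ (m ∸ j)) ≡ ∑ (suc m) (λ k → + f k * (+ (k C j) * ((+ 2 * a) ^ j * b ^ (m ∸ j))))
    expand j = begin
      + g j * (a ^ j * b ^ (m ∸ j))
        ≡⟨ cong (λ z → + z * (a ^ j * b ^ (m ∸ j))) (g≡ j) ⟩
      + sd-fvector (suc m) f j * (a ^ j * b ^ (m ∸ j))
        ≡⟨ cong (_* (a ^ j * b ^ (m ∸ j))) (pos-∑ℕ (suc m) _) ⟩
      ∑ (suc m) (λ k → + ((k C j) ℕ.* 2 ℕ.^ j ℕ.* f k)) * (a ^ j * b ^ (m ∸ j))
        ≡⟨ *-distribʳ-∑ (suc m) _ _ ⟩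
      ∑ (suc m) (λ k → + ((k C j) ℕ.* 2 ℕ.^ j ℕ.* f k) * (a ^ j * b ^ (m ∸ j)))
        ≡⟨ ∑-cong (suc m) (λ k _ → coefficient j k) ⟩
      ∑ (suc m) (λ k → + f k * (+ (k C j) * ((+ 2 * a) ^ j * b ^ (m ∸ j)))) ∎

module CubicalHVectors where

  open FiniteSums
  open BinaryForms
  open PolynomialIdentity
  open SdFVector
  open import Data.Nat as ℕ using (ℕ; zero; suc; _∸_; _≤_; _<_; s≤s)
  import Data.Nat.Properties as ℕ
  open import Data.Integer using (ℤ; +_; -_; -1ℤ; _+_; _*_; _-_; _^_)
  import Data.Integer.Properties as ℤ
  open import Data.Integer.Tactic.RingSolver using (solve-∀)
  open import Function using (_∘_)
  open import Relation.Binary.PropositionalEquality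
  open ≡-Reasoning

  Palindromic : ℕ → (ℕ → ℤ) → Set
  Palindromic m c = ∀ i → i ≤ m → c i ≡ c (m ∸ i)

  module _ (m : ℕ) (c : ℕ → ℤ) where

    form-swap : Palindromic m c → ∀ s t → form m c s t ≡ form m c t s
    form-swap pal s t = begin
      ∑ (suc m) (λ i → c i * (s ^ i * t ^ (m ∸ i)))
        ≡⟨ ∑-reverse (suc m) _ ⟩
      ∑ (suc m) (λ i → c (m ∸ i) * (s ^ (m ∸ i) * t ^ (m ∸ (m ∸ i))))
        ≡⟨ ∑-cong (suc m) (λ i i<sm → cong₂ (λ x y → x * (s ^ (m ∸ i) * t ^ y))
                                            (sym (pal i (ℕ.≤-pred i<sm))) (ℕ.m∸[m∸n]≡n (ℕ.≤-pred i<sm))) ⟩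
      ∑ (suc m) (λ i → c i * (s ^ (m ∸ i) * t ^ i))
        ≡⟨ ∑-cong (suc m) (λ i _ → cong (c i *_) (ℤ.*-comm (s ^ (m ∸ i)) (t ^ i))) ⟩
      ∑ (suc m) (λ i → c i * (t ^ i * s ^ (m ∸ i))) ∎

    private
      form-at-1ʳ : ∀ s → form m c s (+ 1) ≡ ∑ (suc m) (λ i → c i * s ^ i)
      form-at-1ʳ s = ∑-cong (suc m) (λ i _ → cong (c i *_) (begin
        s ^ i * (+ 1) ^ (m ∸ i) ≡⟨ cong (s ^ i *_) (ℤ.^-zeroˡ (m ∸ i)) ⟩
        s ^ i * + 1             ≡⟨ ℤ.*-identityʳ (s ^ i) ⟩
        s ^ i                   ∎))

      form-at-1ˡ : ∀ s → form m c (+ 1) s ≡ ∑ (suc m) (λ i → c (m ∸ i) * s ^ i)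
      form-at-1ˡ s = begin
        ∑ (suc m) (λ i → c i * ((+ 1) ^ i * s ^ (m ∸ i)))
          ≡⟨ ∑-cong (suc m) (λ i _ → cong (λ x → c i * (x * s ^ (m ∸ i))) (ℤ.^-zeroˡ i)) ⟩
        ∑ (suc m) (λ i → c i * (+ 1 * s ^ (m ∸ i)))
          ≡⟨ ∑-cong (suc m) (λ i _ → cong (c i *_) (ℤ.*-identityˡ (s ^ (m ∸ i)))) ⟩
        ∑ (suc m) (λ i → c i * s ^ (m ∸ i))
          ≡⟨ ∑-reverse (suc m) _ ⟩
        ∑ (suc m) (λ i → c (m ∸ i) * s ^ (m ∸ (m ∸ i)))
          ≡⟨ ∑-cong (suc m) (λ i i<sm → cong (λ k → c (m ∸ i) * s ^ k) (ℕ.m∸[m∸n]≡n (ℕ.≤-pred i<sm))) ⟩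
        ∑ (suc m) (λ i → c (m ∸ i) * s ^ i) ∎

    -- Both sides are polynomials in s; their difference has coefficients cᵢ - cₘ₋ᵢ.
    swap⇒palindromic : (∀ s → form m c s (+ 1) ≡ form m c (+ 1) s) → Palindromic m c
    swap⇒palindromic swap i i≤m = ℤ.i-j≡0⇒i≡j (c i) (c (m ∸ i))
      (vanishing-polynomial⇒zero-coefficients (suc m) (λ i → c i - c (m ∸ i)) difference-vanishes i (s≤s i≤m))
      where
      difference-vanishes : ∀ s → ∑ (suc m) (λ i → (c i - c (m ∸ i)) * s ^ i) ≡ + 0
      difference-vanishes s = begin
        ∑ (suc m) (λ i → (c i - c (m ∸ i)) * s ^ i)
          ≡⟨ ∑-cong (suc m) (λ i _ → distribʳ (c i) (c (m ∸ i)) (s ^ i)) ⟩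
        ∑ (suc m) (λ i → c i * s ^ i - c (m ∸ i) * s ^ i)
          ≡⟨ ∑-distrib-minus (suc m) _ _ ⟩
        ∑ (suc m) (λ i → c i * s ^ i) - ∑ (suc m) (λ i → c (m ∸ i) * s ^ i)
          ≡⟨ cong₂ _-_ (form-at-1ʳ s) (form-at-1ˡ s) ⟨
        form m c s (+ 1) - form m c (+ 1) s
          ≡⟨ cong (_- form m c (+ 1) s) (swap s) ⟩
        form m c (+ 1) s - form m c (+ 1) s
          ≡⟨ ℤ.+-inverseʳ (form m c (+ 1) s) ⟩
        + 0 ∎
        where
        distribʳ : ∀ a b S → (a - b) * S ≡ a * S - b * S
        distribʳ = solve-∀

  module AdjacentSums {a c : ℕ → ℤ} (adjacent : ∀ i → c i ≡ a i + a (suc i)) where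

    private
      next : ∀ i → a (suc i) ≡ c i - a i
      next i = begin
        a (suc i)               ≡⟨ cancel (a i) (a (suc i)) ⟩
        a i + a (suc i) - a i   ≡⟨ cong (_- a i) (adjacent i) ⟨
        c i - a i               ∎
        where
        cancel : ∀ x y → y ≡ x + y - x
        cancel = solve-∀

      suc-∸ : ∀ {m i} → i ≤ m → suc m ∸ i ≡ suc (m ∸ i)
      suc-∸ i≤m = ℕ.+-∸-assoc 1 i≤m

    symmetric⇒palindromic : ∀ m → Symmetric (suc m) a → Palindromic m c
    symmetric⇒palindromic m sym-a i i≤m = begin
      c i                         ≡⟨ adjacent i ⟩
      a i + a (suc i)             ≡⟨ cong₂ _+_ (trans (sym-a i (ℕ.m≤n⇒m≤1+n i≤m)) (cong a (suc-∸ i≤m))) (sym-a (suc i) (s≤s i≤m)) ⟩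
      a (suc (m ∸ i)) + a (m ∸ i) ≡⟨ ℤ.+-comm (a (suc (m ∸ i))) (a (m ∸ i)) ⟩
      a (m ∸ i) + a (suc (m ∸ i)) ≡⟨ adjacent (m ∸ i) ⟨
      c (m ∸ i)                   ∎

    palindromic⇒symmetric : ∀ m → a (suc m) ≡ a 0 → Palindromic m c → Symmetric (suc m) a
    palindromic⇒symmetric m top pal zero    _         = sym top
    palindromic⇒symmetric m top pal (suc i) (s≤s i≤m) = begin
      a (suc i)                     ≡⟨ next i ⟩
      c i - a i                     ≡⟨ cong₂ _-_ (pal i i≤m) (palindromic⇒symmetric m top pal i (ℕ.m≤n⇒m≤1+n i≤m)) ⟩
      c (m ∸ i) - a (suc m ∸ i)     ≡⟨ cong (λ k → c (m ∸ i) - a k) (suc-∸ i≤m) ⟩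
      c (m ∸ i) - a (suc (m ∸ i))   ≡⟨ cong (_-_ (c (m ∸ i))) (next (m ∸ i)) ⟩
      c (m ∸ i) - (c (m ∸ i) - a (m ∸ i)) ≡⟨ cancel (c (m ∸ i)) (a (m ∸ i)) ⟩
      a (m ∸ i)                     ∎
      where
      cancel : ∀ x y → x - (x - y) ≡ y
      cancel = solve-∀

    alternating-sum : ∀ k → -1ℤ ^ k * a k ≡ a 0 - ∑ k (λ i → -1ℤ ^ i * c i)
    alternating-sum zero    = rearrange (a 0)
      where
      rearrange : ∀ x → + 1 * x ≡ x - + 0
      rearrange = solve-∀
    alternating-sum (suc k) = begin
      -1ℤ * -1ℤ ^ k * a (suc k)                     ≡⟨ cong (-1ℤ * -1ℤ ^ k *_) (next k) ⟩
      -1ℤ * -1ℤ ^ k * (c k - a k)                   ≡⟨ rearrange (-1ℤ ^ k) (c k) (a k) ⟩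
      -1ℤ ^ k * a k - -1ℤ ^ k * c k                 ≡⟨ cong (_- -1ℤ ^ k * c k) (alternating-sum k) ⟩
      a 0 - ∑ k (λ i → -1ℤ ^ i * c i) - -1ℤ ^ k * c k ≡⟨ ℤ.+-assoc (a 0) _ _ ⟩
      a 0 + (- ∑ k (λ i → -1ℤ ^ i * c i) - -1ℤ ^ k * c k) ≡⟨ cong (_+_ (a 0)) (ℤ.neg-distrib-+ (∑ k (λ i → -1ℤ ^ i * c i)) (-1ℤ ^ k * c k)) ⟨
      a 0 - ∑ (suc k) (λ i → -1ℤ ^ i * c i)         ∎
      where
      rearrange : ∀ u x y → - (+ 1) * u * (x - y) ≡ u * y - u * x
      rearrange = solve-∀

    top-entry : ∀ m → -1ℤ ^ suc m * a (suc m) ≡ a 0 - form m c -1ℤ (+ 1)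
    top-entry m = trans (alternating-sum (suc m)) (cong (_-_ (a 0)) (∑-cong (suc m) (λ i _ → begin
      -1ℤ ^ i * c i                         ≡⟨ ℤ.*-comm (-1ℤ ^ i) (c i) ⟩
      c i * -1ℤ ^ i                         ≡⟨ cong (c i *_) (ℤ.*-identityʳ (-1ℤ ^ i)) ⟨
      c i * (-1ℤ ^ i * + 1)                 ≡⟨ cong (λ x → c i * (-1ℤ ^ i * x)) (ℤ.^-zeroˡ (m ∸ i)) ⟨
      c i * (-1ℤ ^ i * (+ 1) ^ (m ∸ i))     ∎)))

  hsc≡hc+hc : ∀ d f i → hsc d f i ≡ hc d f i + hc d f (suc i)
  hsc≡hc+hc d f i = rearrange (hsc d f i) (hc d f i)
    where
    rearrange : ∀ x y → x ≡ y + (x - y)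
    rearrange = solve-∀

  module HVector d f = AdjacentSums {hc d f} {hsc d f} (hsc≡hc+hc d f)

  hsc-form : ∀ m f s t → form m (hsc (suc m) f) s t ≡ form m (+_ ∘ f) (+ 2 * s) (t - s)
  hsc-form m f s t = trans (sym (homog≡form (shortPoly (suc m) f) m s t (length-shortPoly m f))) (homog-shortPoly m f s t)

  module _ (m : ℕ) (f g : ℕ → ℕ) (g≡sd-f : ∀ j → g j ≡ sd-fvector (suc m) f j) where

    private
      X Y : ℤ → ℤ → ℤ
      X s t = + 2 * (+ 2 * s) + (t - s)
      Y s t = t - s

      scaled-hsc-form : ∀ s t → (+ 2) ^ m * form m (hsc (suc m) g) s t ≡ form m (+_ ∘ f) (+ 2 * X s t) (+ 2 * Y s t)
      scaled-hsc-form s t = begin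
        (+ 2) ^ m * form m (hsc (suc m) g) s t
          ≡⟨ cong ((+ 2) ^ m *_) (trans (hsc-form m g s t) (form-sd m f g g≡sd-f (+ 2 * s) (t - s))) ⟩
        (+ 2) ^ m * form m (+_ ∘ f) (X s t) (Y s t)
          ≡⟨ form-homogeneous m (+_ ∘ f) (X s t) (Y s t) ⟨
        form m (+_ ∘ f) (+ 2 * X s t) (+ 2 * Y s t)      ∎

    hsc-swap-sd : (∀ s t → form m (hsc (suc m) f) s t ≡ form m (hsc (suc m) f) t s) →
                  ∀ s t → form m (hsc (suc m) g) s t ≡ form m (hsc (suc m) g) t s
    hsc-swap-sd swap-f s t = *-cancelˡ-^ (+ 2) m (λ ()) (begin
      (+ 2) ^ m * form m (hsc (suc m) g) s t               ≡⟨ scaled-hsc-form s t ⟩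
      form m (+_ ∘ f) (+ 2 * X s t) (+ 2 * Y s t)          ≡⟨ cong (form m (+_ ∘ f) (+ 2 * X s t)) (diff₁ (X s t) (Y s t)) ⟨
      form m (+_ ∘ f) (+ 2 * X s t) (t′ - X s t)           ≡⟨ hsc-form m f (X s t) t′ ⟨
      form m (hsc (suc m) f) (X s t) t′                    ≡⟨ swap-f (X s t) t′ ⟩
      form m (hsc (suc m) f) t′ (X s t)                    ≡⟨ hsc-form m f t′ (X s t) ⟩
      form m (+_ ∘ f) (+ 2 * t′) (X s t - t′)              ≡⟨ cong₂ (form m (+_ ∘ f)) (sum₂ s t) (diff₂ s t) ⟩
      form m (+_ ∘ f) (+ 2 * X t s) (+ 2 * Y t s)          ≡⟨ scaled-hsc-form t s ⟨
      (+ 2) ^ m * form m (hsc (suc m) g) t s               ∎)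
      where
      t′ : ℤ
      t′ = X s t + + 2 * Y s t
      diff₁ : ∀ x y → x + + 2 * y - x ≡ + 2 * y
      diff₁ = solve-∀
      sum₂ : ∀ s t → + 2 * (+ 2 * (+ 2 * s) + (t - s) + + 2 * (t - s)) ≡ + 2 * (+ 2 * (+ 2 * t) + (s - t))
      sum₂ = solve-∀
      diff₂ : ∀ s t → + 2 * (+ 2 * s) + (t - s) - (+ 2 * (+ 2 * s) + (t - s) + + 2 * (t - s)) ≡ + 2 * (s - t)
      diff₂ = solve-∀

    hc-top-sd : hc (suc m) g (suc m) ≡ hc (suc m) f (suc m)
    hc-top-sd = *-cancelˡ-^ -1ℤ (suc m) (λ ()) (begin
      -1ℤ ^ suc m * hc (suc m) g (suc m)
        ≡⟨ HVector.top-entry (suc m) g m ⟩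
      hc (suc m) g 0 - form m (hsc (suc m) g) -1ℤ (+ 1)
        ≡⟨ cong (_-_ (hc (suc m) g 0)) (trans (hsc-form m g -1ℤ (+ 1)) (form-sd m f g g≡sd-f _ _)) ⟩
      hc (suc m) f 0 - form m (+_ ∘ f) (- + 2) (+ 2)
        ≡⟨ cong (_-_ (hc (suc m) f 0)) (hsc-form m f -1ℤ (+ 1)) ⟨
      hc (suc m) f 0 - form m (hsc (suc m) f) -1ℤ (+ 1)
        ≡⟨ HVector.top-entry (suc m) f m ⟨
      -1ℤ ^ suc m * hc (suc m) f (suc m)                    ∎)

    symmetric-hc-sd : Symmetric (suc m) (hc (suc m) f) → Symmetric (suc m) (hc (suc m) g)
    symmetric-hc-sd sym-f = HVector.palindromic⇒symmetric (suc m) g m top palindromic-g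
      where
      palindromic-g : Palindromic m (hsc (suc m) g)
      palindromic-g = swap⇒palindromic m (hsc (suc m) g) (λ s →
        hsc-swap-sd (form-swap m (hsc (suc m) f) (HVector.symmetric⇒palindromic (suc m) f m sym-f)) s (+ 1))
      top : hc (suc m) g (suc m) ≡ hc (suc m) g 0
      top = trans hc-top-sd (trans (sym-f (suc m) ℕ.≤-refl) (cong (hc (suc m) f) (ℕ.n∸n≡0 m)))

module CubeFaces where

  open import Data.Bool using (Bool; true; false)
  open import Data.Nat as ℕ using (ℕ; zero; suc; _≤_; _+_; z≤n; s≤s)
  import Data.Nat.Properties as ℕ
  open import Data.Fin as Fin using (Fin; combine; quotient; remainder; remQuot)
  import Data.Fin.Properties as Fin
  open import Data.Vec using (Vec; []; _∷_; replicate)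
  import Data.Vec.Properties as Vec
  open import Data.Product using (∃; _,_; proj₁; proj₂; uncurry)
  open import Function using (Inverse; _∘_)
  open import Function.Definitions using (Injective)
  open import Relation.Nullary using (Dec; yes; no; contradiction)
  open import Relation.Nullary.Decidable using (map′)
  open import Relation.Binary.PropositionalEquality
  open ≡-Reasoning

  open Inverse Fin.2↔Bool using () renaming (to to bool; from to bit; strictlyInverseˡ to bool-bit; strictlyInverseʳ to bit-bool)

  encode : ∀ {m} → Vec Bool m → Fin (2 ℕ.^ m)
  encode []      = Fin.zero
  encode (b ∷ v) = combine (bit b) (encode v)

  decode : ∀ m → Fin (2 ℕ.^ m) → Vec Bool m
  decode zero    _ = []
  decode (suc m) i = bool (quotient (2 ℕ.^ m) i) ∷ decode m (remainder {2} (2 ℕ.^ m) i)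

  decode-encode : ∀ {m} (v : Vec Bool m) → decode m (encode v) ≡ v
  decode-encode []      = refl
  decode-encode {suc m} (b ∷ v) = cong₂ _∷_
    (trans (cong (bool ∘ proj₁) split) (bool-bit b))
    (trans (cong (decode m ∘ proj₂) split) (decode-encode v))
    where
    split : remQuot (2 ℕ.^ m) (combine (bit b) (encode v)) ≡ (bit b , encode v)
    split = Fin.remQuot-combine (bit b) (encode v)

  encode-decode : ∀ m (i : Fin (2 ℕ.^ m)) → encode (decode m i) ≡ i
  encode-decode zero    Fin.zero = refl
  encode-decode (suc m) i = begin
    combine (bit (bool (quotient (2 ℕ.^ m) i))) (encode (decode m (remainder {2} (2 ℕ.^ m) i)))
      ≡⟨ cong₂ combine (bit-bool (quotient (2 ℕ.^ m) i)) (encode-decode m (remainder {2} (2 ℕ.^ m) i)) ⟩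
    uncurry combine (remQuot {2} (2 ℕ.^ m) i)
      ≡⟨ Fin.combine-remQuot {2} (2 ℕ.^ m) i ⟩
    i ∎

  cube-injection⇒≤ : ∀ {a b} (f : Vec Bool a → Vec Bool b) → Injective _≡_ _≡_ f → a ≤ b
  cube-injection⇒≤ {a} {b} f f-injective = ℕ.≮⇒≥ λ b<a →
    contradiction (Fin.injective⇒≤ g-injective) (ℕ.<⇒≱ (ℕ.^-monoʳ-< 2 (s≤s (s≤s z≤n)) b<a))
    where
    g : Fin (2 ℕ.^ a) → Fin (2 ℕ.^ b)
    g = encode ∘ f ∘ decode a
    g-injective : Injective _≡_ _≡_ g
    g-injective {i} {j} gi≡gj = begin
      i                   ≡⟨ encode-decode a i ⟨
      encode (decode a i) ≡⟨ cong encode (f-injective (begin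
        f (decode a i)                     ≡⟨ decode-encode (f (decode a i)) ⟨
        decode b (encode (f (decode a i))) ≡⟨ cong (decode b) gi≡gj ⟩
        decode b (encode (f (decode a j))) ≡⟨ decode-encode (f (decode a j)) ⟩
        f (decode a j)                     ∎)) ⟩
      encode (decode a j) ≡⟨ encode-decode a j ⟩
      j                   ∎

  ∃-cube? : ∀ m {P : Vec Bool m → Set} → (∀ v → Dec (P v)) → Dec (∃ P)
  ∃-cube? m {P} P? = map′ (λ (i , p) → decode m i , p) (λ (v , p) → encode v , subst P (sym (decode-encode v)) p)
                          (Fin.any? (P? ∘ decode m))

  _≟ᶜ_ : (a b : CubeCoord) → Dec (a ≡ b)
  fix0 ≟ᶜ fix0 = yes refl
  fix1 ≟ᶜ fix1 = yes refl
  free ≟ᶜ free = yes refl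
  fix0 ≟ᶜ fix1 = no λ ()
  fix0 ≟ᶜ free = no λ ()
  fix1 ≟ᶜ fix0 = no λ ()
  fix1 ≟ᶜ free = no λ ()
  free ≟ᶜ fix0 = no λ ()
  free ≟ᶜ fix1 = no λ ()

  dimension codimension : ∀ {m} → Vec CubeCoord m → ℕ
  dimension []         = 0
  dimension (free ∷ c) = suc (dimension c)
  dimension (fix0 ∷ c) = dimension c
  dimension (fix1 ∷ c) = dimension c
  codimension []         = 0
  codimension (free ∷ c) = codimension c
  codimension (fix0 ∷ c) = suc (codimension c)
  codimension (fix1 ∷ c) = suc (codimension c)

  dimension+codimension : ∀ {m} (c : Vec CubeCoord m) → dimension c + codimension c ≡ m
  dimension+codimension []         = refl
  dimension+codimension (free ∷ c) = cong suc (dimension+codimension c)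
  dimension+codimension (fix0 ∷ c) = trans (ℕ.+-suc (dimension c) (codimension c)) (cong suc (dimension+codimension c))
  dimension+codimension (fix1 ∷ c) = trans (ℕ.+-suc (dimension c) (codimension c)) (cong suc (dimension+codimension c))

  project : ∀ {m} (c : Vec CubeCoord m) → Vec Bool m → Vec Bool (dimension c)
  project []         []      = []
  project (free ∷ c) (b ∷ v) = b ∷ project c v
  project (fix0 ∷ c) (b ∷ v) = project c v
  project (fix1 ∷ c) (b ∷ v) = project c v

  embed : ∀ {m} (c : Vec CubeCoord m) → Vec Bool (dimension c) → Vec Bool m
  embed []         []      = []
  embed (free ∷ c) (b ∷ u) = b ∷ embed c u
  embed (fix0 ∷ c) u       = false ∷ embed c u
  embed (fix1 ∷ c) u       = true ∷ embed c u

  embed-lies-in : ∀ {m} (c : Vec CubeCoord m) u → embed c u lies-in c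
  embed-lies-in []         []      = []
  embed-lies-in (free ∷ c) (b ∷ u) = onF b (embed-lies-in c u)
  embed-lies-in (fix0 ∷ c) u       = on0 (embed-lies-in c u)
  embed-lies-in (fix1 ∷ c) u       = on1 (embed-lies-in c u)

  project-embed : ∀ {m} (c : Vec CubeCoord m) u → project c (embed c u) ≡ u
  project-embed []         []      = refl
  project-embed (free ∷ c) (b ∷ u) = cong (b ∷_) (project-embed c u)
  project-embed (fix0 ∷ c) u       = project-embed c u
  project-embed (fix1 ∷ c) u       = project-embed c u

  project-injective : ∀ {m} {c : Vec CubeCoord m} {v w} → v lies-in c → w lies-in c → project c v ≡ project c w → v ≡ w
  project-injective []          []          eq = refl
  project-injective (onF b v∈c) (onF _ w∈c) eq = cong₂ _∷_ (Vec.∷-injectiveˡ eq) (project-injective v∈c w∈c (Vec.∷-injectiveʳ eq))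
  project-injective (on0 v∈c)   (on0 w∈c)   eq = cong (false ∷_) (project-injective v∈c w∈c eq)
  project-injective (on1 v∈c)   (on1 w∈c)   eq = cong (true ∷_) (project-injective v∈c w∈c eq)

  lies-in-tail : ∀ {m} {b a} {v : Vec Bool m} {c} → (b ∷ v) lies-in (a ∷ c) → v lies-in c
  lies-in-tail (on0 v∈c)   = v∈c
  lies-in-tail (on1 v∈c)   = v∈c
  lies-in-tail (onF _ v∈c) = v∈c

  lies-in? : ∀ {m} (v : Vec Bool m) c → Dec (v lies-in c)
  lies-in? []          []         = yes []
  lies-in? (b ∷ v)     (free ∷ c) = map′ (onF b) lies-in-tail (lies-in? v c)
  lies-in? (false ∷ v) (fix0 ∷ c) = map′ on0 lies-in-tail (lies-in? v c)
  lies-in? (true ∷ v)  (fix1 ∷ c) = map′ on1 lies-in-tail (lies-in? v c)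
  lies-in? (true ∷ v)  (fix0 ∷ c) = no λ ()
  lies-in? (false ∷ v) (fix1 ∷ c) = no λ ()

  _⊑_ : ∀ {m} → Vec CubeCoord m → Vec CubeCoord m → Set
  c ⊑ c′ = ∀ v → v lies-in c → v lies-in c′

  ⊑-antisym : ∀ {m} {c c′ : Vec CubeCoord m} → c ⊑ c′ → c′ ⊑ c → c ≡ c′
  ⊑-antisym {c = []}    {[]}      _ _ = refl
  ⊑-antisym {c = a ∷ c} {a′ ∷ c′} c⊑c′ c′⊑c =
    cong₂ _∷_ (heads a a′ (embed-lies-in c all-false) (embed-lies-in c′ all-false) c⊑c′ c′⊑c)
              (⊑-antisym (tails a c⊑c′) (tails a′ c′⊑c))
    where
    all-false : ∀ {k} → Vec Bool k
    all-false = replicate _ false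
    tails : ∀ {c c′} a {a′} → (a ∷ c) ⊑ (a′ ∷ c′) → c ⊑ c′
    tails free c⊑c′ v v∈c = lies-in-tail (c⊑c′ _ (onF false v∈c))
    tails fix0 c⊑c′ v v∈c = lies-in-tail (c⊑c′ _ (on0 v∈c))
    tails fix1 c⊑c′ v v∈c = lies-in-tail (c⊑c′ _ (on1 v∈c))
    heads : ∀ a a′ {c c′ w w′} → w lies-in c → w′ lies-in c′ → (a ∷ c) ⊑ (a′ ∷ c′) → (a′ ∷ c′) ⊑ (a ∷ c) → a ≡ a′
    heads free free _ _  _  _  = refl
    heads fix0 fix0 _ _  _  _  = refl
    heads fix1 fix1 _ _  _  _  = refl
    heads free fix0 w _  ⊑′ _  with ⊑′ _ (onF true w)
    ... | ()
    heads free fix1 w _  ⊑′ _  with ⊑′ _ (onF false w)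
    ... | ()
    heads fix0 free _ w′ _  ⊒′ with ⊒′ _ (onF true w′)
    ... | ()
    heads fix1 free _ w′ _  ⊒′ with ⊒′ _ (onF false w′)
    ... | ()
    heads fix0 fix1 w _  ⊑′ _  with ⊑′ _ (on0 w)
    ... | ()
    heads fix1 fix0 w _  ⊑′ _  with ⊑′ _ (on1 w)
    ... | ()

module Subfaces {n : ℕ} (K : CubicalComplex n) (G : Subset n) (G-face : isFace K G ≡ true) where

  open CubeFaces
  open import Data.Bool using (Bool; T)
  open import Data.Bool.Properties using (T-≡)
  open import Data.Nat as ℕ using (_∸_)
  import Data.Nat.Properties as ℕ
  open import Data.Fin as Fin using (Fin)
  open import Data.Fin.Subset using (_∈_; _⊆_)
  open import Data.Fin.Subset.Properties using (⊆-antisym)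
  open import Data.Vec using (Vec; tabulate)
  import Data.Vec.Properties as Vec
  open import Data.Product using (Σ; ∃; _×_; _,_; proj₁)
  open import Relation.Nullary.Decidable using (Dec; ⌊_⌋; _×-dec_; toWitness; fromWitness)
  open import Function using (_⇔_; Equivalence; mk⇔; _∘_)
  open import Relation.Binary.PropositionalEquality
  open ≡-Reasoning
  open Equivalence

  m : ℕ
  m = dim K G

  vertex : Vec Bool m → Fin n
  vertex = vert K G G-face

  _∈ᵛ_ : Fin n → Vec CubeCoord m → Set
  x ∈ᵛ c = ∃ λ v → v lies-in c × vertex v ≡ x

  _∈ᵛ?_ : ∀ x c → Dec (x ∈ᵛ c)
  x ∈ᵛ? c = ∃-cube? m (λ v → lies-in? v c ×-dec (vertex v Fin.≟ x))

  subface : Vec CubeCoord m → Subset n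
  subface c = tabulate (λ x → ⌊ x ∈ᵛ? c ⌋)

  ∈-subface : ∀ c x → x ∈ subface c ⇔ x ∈ᵛ c
  ∈-subface c x = mk⇔
    (λ x∈ → toWitness (from T-≡ (trans (sym (Vec.lookup∘tabulate _ x)) (Vec.[]=⇒lookup x∈))))
    (λ x∈ᵛ → Vec.lookup⇒[]= x (subface c) (trans (Vec.lookup∘tabulate _ x) (to T-≡ (fromWitness x∈ᵛ))))

  subface⊆G : ∀ c → subface c ⊆ G
  subface⊆G c {x} x∈ with to (∈-subface c x) x∈
  ... | v , _ , vertex-v≡x = from (vert-set K G G-face x) (v , vertex-v≡x)

  subface-isFace : ∀ c → isFace K (subface c) ≡ true
  subface-isFace c = from (faces-of-face K G G-face (subface c) (subface⊆G c)) (c , ∈-subface c)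

  subface-injective : ∀ {c c′} → subface c ≡ subface c′ → c ≡ c′
  subface-injective eq = ⊑-antisym (included eq) (included (sym eq))
    where
    included : ∀ {c c′} → subface c ≡ subface c′ → c ⊑ c′
    included {c} {c′} eq v v∈c with to (∈-subface c′ (vertex v)) (subst (vertex v ∈_) eq (from (∈-subface c (vertex v)) (v , v∈c , refl)))
    ... | w , w∈c′ , vertex-w≡vertex-v = subst (_lies-in c′) (vert-inj K G G-face vertex-w≡vertex-v) w∈c′

  -- The cubes T and c have the same vertices, so each Boolean cube injects into the other.
  dim≡dimension : ∀ T (T-face : isFace K T ≡ true) c → (∀ x → x ∈ T ⇔ x ∈ᵛ c) → dim K T ≡ dimension c
  dim≡dimension T T-face c T≈c = ℕ.≤-antisym (cube-injection⇒≤ into into-injective) (cube-injection⇒≤ back back-injective)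
    where
    vertexᵀ : Vec Bool (dim K T) → Fin n
    vertexᵀ = vert K T T-face
    witness : ∀ v → vertexᵀ v ∈ᵛ c
    witness v = to (T≈c (vertexᵀ v)) (from (vert-set K T T-face (vertexᵀ v)) (v , refl))
    into : Vec Bool (dim K T) → Vec Bool (dimension c)
    into v = project c (proj₁ (witness v))
    into-injective : ∀ {v v′} → into v ≡ into v′ → v ≡ v′
    into-injective {v} {v′} eq with witness v | witness v′
    ... | w , w∈c , e | w′ , w′∈c , e′ = vert-inj K T T-face (trans (sym e) (trans (cong vertex (project-injective w∈c w′∈c eq)) e′))
    preimage : ∀ u → Σ (Vec Bool (dim K T)) λ v → vertexᵀ v ≡ vertex (embed c u)
    preimage u = to (vert-set K T T-face _) (from (T≈c _) (embed c u , embed-lies-in c u , refl))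
    back : Vec Bool (dimension c) → Vec Bool (dim K T)
    back = proj₁ ∘ preimage
    back-injective : ∀ {u u′} → back u ≡ back u′ → u ≡ u′
    back-injective {u} {u′} eq with preimage u | preimage u′
    ... | v , e | v′ , e′ = begin
      u                          ≡⟨ project-embed c u ⟨
      project c (embed c u)      ≡⟨ cong (project c) (vert-inj K G G-face (trans (sym e) (trans (cong vertexᵀ eq) e′))) ⟩
      project c (embed c u′)     ≡⟨ project-embed c u′ ⟩
      u′                         ∎

  subface-surjective : ∀ T → isFace K T ≡ true → T ⊆ G →
                       Σ (Vec CubeCoord m) λ c → subface c ≡ T × m ∸ dim K T ≡ codimension c
  subface-surjective T T-face T⊆G with to (faces-of-face K G G-face T T⊆G) T-face
  ... | c , T≈c = c
    , ⊆-antisym (λ {x} x∈ → from (T≈c x) (to (∈-subface c x) x∈)) (λ {x} x∈ → from (∈-subface c x) (to (T≈c x) x∈))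
    , (begin
        m ∸ dim K T                               ≡⟨ cong (m ∸_) (dim≡dimension T T-face c T≈c) ⟩
        m ∸ dimension c                           ≡⟨ cong (_∸ dimension c) (dimension+codimension c) ⟨
        dimension c ℕ.+ codimension c ∸ dimension c ≡⟨ ℕ.m+n∸m≡n (dimension c) (codimension c) ⟩
        codimension c                             ∎)

module FaceCounting where

  open CubeFaces
  open FiniteSums using (∑ℕ; ∑ℕ-cong)
  open SdFVector using (sd-fvector)
  open import Data.Bool as Bool using (Bool; true; false; if_then_else_)
  open import Data.Nat as ℕ using (ℕ; zero; suc; _∸_; _≤_; _<_; s≤s; _+_; _*_; _^_; _≡ᵇ_)
  import Data.Nat.Properties as ℕ
  open import Data.Nat.Combinatorics using (_C_; nCk+nC[k+1]≡[n+1]C[k+1])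
  open import Data.Nat.Tactic.RingSolver using (solve-∀)
  open import Data.Fin.Subset using (Subset; _⊆_)
  open import Data.Fin.Subset.Properties using (_⊆?_)
  open import Data.Vec using (Vec; []; _∷_)
  import Data.Vec.Properties as Vec
  open import Data.List using (List; []; _∷_; map; concatMap; length; filter; _++_)
  open import Data.Product using (_×_; _,_)
  open import Data.Sum using (inj₁; inj₂)
  open import Function using (_∘_)
  open import Relation.Nullary using (Dec; yes; no; ¬_; contradiction)
  open import Relation.Nullary.Decidable using (⌊_⌋)
  open import Relation.Binary using (DecidableEquality)
  open import Relation.Binary.PropositionalEquality
  open ≡-Reasoning

  χ : Bool → ℕ
  χ b = if b then 1 else 0

  χ-yes : ∀ {P : Set} (P? : Dec P) → P → χ ⌊ P? ⌋ ≡ 1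
  χ-yes (yes _) _ = refl
  χ-yes (no ¬p) p = contradiction p ¬p

  χ-no : ∀ {P : Set} (P? : Dec P) → ¬ P → χ ⌊ P? ⌋ ≡ 0
  χ-no (yes p) ¬p = contradiction p ¬p
  χ-no (no _)  _  = refl

  private
    variable
      A B : Set

  χ-≡ᵇ-refl : ∀ x → χ (x ≡ᵇ x) ≡ 1
  χ-≡ᵇ-refl zero    = refl
  χ-≡ᵇ-refl (suc x) = χ-≡ᵇ-refl x

  χ-≡ᵇ-≢ : ∀ {x k} → x ≢ k → χ (x ≡ᵇ k) ≡ 0
  χ-≡ᵇ-≢ {zero}  {zero}  x≢k = contradiction refl x≢k
  χ-≡ᵇ-≢ {zero}  {suc k} x≢k = refl
  χ-≡ᵇ-≢ {suc x} {zero}  x≢k = refl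
  χ-≡ᵇ-≢ {suc x} {suc k} x≢k = χ-≡ᵇ-≢ (x≢k ∘ cong suc)

  ∑ℕ-select : ∀ d (h : ℕ → ℕ) {x} → x < d → ∑ℕ d (λ k → h k * χ (x ≡ᵇ k)) ≡ h x
  ∑ℕ-select (suc d) h {x} (s≤s x≤d) with ℕ.m≤n⇒m<n∨m≡n x≤d
  ... | inj₁ x<d  = begin
    ∑ℕ d (λ k → h k * χ (x ≡ᵇ k)) + h d * χ (x ≡ᵇ d) ≡⟨ cong₂ _+_ (∑ℕ-select d h x<d) (cong (h d *_) (χ-≡ᵇ-≢ (ℕ.<⇒≢ x<d))) ⟩
    h x + h d * 0                                    ≡⟨ cong (h x +_) (ℕ.*-zeroʳ (h d)) ⟩
    h x + 0                                          ≡⟨ ℕ.+-identityʳ (h x) ⟩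
    h x                                              ∎
  ... | inj₂ refl = begin
    ∑ℕ x (λ k → h k * χ (x ≡ᵇ k)) + h x * χ (x ≡ᵇ x) ≡⟨ cong₂ _+_ (below-x x ℕ.≤-refl) (cong (h x *_) (χ-≡ᵇ-refl x)) ⟩
    0 + h x * 1                                      ≡⟨ ℕ.*-identityʳ (h x) ⟩
    h x                                              ∎
    where
    below-x : ∀ d → d ≤ x → ∑ℕ d (λ k → h k * χ (x ≡ᵇ k)) ≡ 0
    below-x zero    _   = refl
    below-x (suc d) d<x = cong₂ _+_ (below-x d (ℕ.<⇒≤ d<x)) (trans (cong (h d *_) (χ-≡ᵇ-≢ (ℕ.>⇒≢ d<x))) (ℕ.*-zeroʳ (h d)))

  ∑ᴸ : List A → (A → ℕ) → ℕ
  ∑ᴸ []       f = 0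
  ∑ᴸ (x ∷ xs) f = f x + ∑ᴸ xs f


  ∑ᴸ-cong : ∀ (xs : List A) {f g : A → ℕ} → (∀ x → f x ≡ g x) → ∑ᴸ xs f ≡ ∑ᴸ xs g
  ∑ᴸ-cong []       eq = refl
  ∑ᴸ-cong (x ∷ xs) eq = cong₂ _+_ (eq x) (∑ᴸ-cong xs eq)

  ∑ᴸ-zero : ∀ (xs : List A) {f : A → ℕ} → (∀ x → f x ≡ 0) → ∑ᴸ xs f ≡ 0
  ∑ᴸ-zero []       eq = refl
  ∑ᴸ-zero (x ∷ xs) eq = cong₂ _+_ (eq x) (∑ᴸ-zero xs eq)

  ∑ᴸ-++ : ∀ (xs ys : List A) (f : A → ℕ) → ∑ᴸ (xs ++ ys) f ≡ ∑ᴸ xs f + ∑ᴸ ys f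
  ∑ᴸ-++ []       ys f = refl
  ∑ᴸ-++ (x ∷ xs) ys f = trans (cong (f x +_) (∑ᴸ-++ xs ys f)) (sym (ℕ.+-assoc (f x) _ _))

  ∑ᴸ-map : ∀ (g : A → B) xs (f : B → ℕ) → ∑ᴸ (map g xs) f ≡ ∑ᴸ xs (f ∘ g)
  ∑ᴸ-map g []       f = refl
  ∑ᴸ-map g (x ∷ xs) f = cong (f (g x) +_) (∑ᴸ-map g xs f)

  ∑ᴸ-concatMap : ∀ (g : A → List B) xs (f : B → ℕ) → ∑ᴸ (concatMap g xs) f ≡ ∑ᴸ xs (λ x → ∑ᴸ (g x) f)
  ∑ᴸ-concatMap g []       f = refl
  ∑ᴸ-concatMap g (x ∷ xs) f = trans (∑ᴸ-++ (g x) (concatMap g xs) f) (cong (∑ᴸ (g x) f +_) (∑ᴸ-concatMap g xs f))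

  ∑ᴸ-filter : ∀ (p : A → Bool) xs (f : A → ℕ) → ∑ᴸ (filter (λ x → p x Bool.≟ true) xs) f ≡ ∑ᴸ xs (λ x → if p x then f x else 0)
  ∑ᴸ-filter p []       f = refl
  ∑ᴸ-filter p (x ∷ xs) f with p x
  ... | true  = cong (f x +_) (∑ᴸ-filter p xs f)
  ... | false = ∑ᴸ-filter p xs f

  count≡∑ᴸ : ∀ (p : A → Bool) xs → count p xs ≡ ∑ᴸ xs (χ ∘ p)
  count≡∑ᴸ p xs = trans (length≡∑ᴸ (filter (λ x → p x Bool.≟ true) xs)) (trans (∑ᴸ-filter p xs _) (∑ᴸ-cong xs if-χ))
    where
    length≡∑ᴸ : ∀ ys → length ys ≡ ∑ᴸ ys (λ _ → 1)
    length≡∑ᴸ []       = refl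
    length≡∑ᴸ (y ∷ ys) = cong suc (length≡∑ᴸ ys)
    if-χ : ∀ x → (if p x then 1 else 0) ≡ χ (p x)
    if-χ x = refl

  *-distribˡ-∑ᴸ : ∀ (xs : List A) a (f : A → ℕ) → a * ∑ᴸ xs f ≡ ∑ᴸ xs (λ x → a * f x)
  *-distribˡ-∑ᴸ []       a f = ℕ.*-zeroʳ a
  *-distribˡ-∑ᴸ (x ∷ xs) a f = trans (ℕ.*-distribˡ-+ a (f x) _) (cong (a * f x +_) (*-distribˡ-∑ᴸ xs a f))

  ∑ᴸ-distrib-+ : ∀ (xs : List A) (f g : A → ℕ) → ∑ᴸ xs (λ x → f x + g x) ≡ ∑ᴸ xs f + ∑ᴸ xs g
  ∑ᴸ-distrib-+ []       f g = refl
  ∑ᴸ-distrib-+ (x ∷ xs) f g = trans (cong (f x + g x +_) (∑ᴸ-distrib-+ xs f g)) (interchange (f x) (g x) _ _)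
    where
    interchange : ∀ a b c e → a + b + (c + e) ≡ a + c + (b + e)
    interchange = solve-∀

  ∑ᴸ-comm : ∀ (xs : List A) (ys : List B) (f : A → B → ℕ) → ∑ᴸ xs (λ x → ∑ᴸ ys (f x)) ≡ ∑ᴸ ys (λ y → ∑ᴸ xs (λ x → f x y))
  ∑ᴸ-comm []       ys f = sym (∑ᴸ-zero ys (λ _ → refl))
  ∑ᴸ-comm (x ∷ xs) ys f = trans (cong (∑ᴸ ys (f x) +_) (∑ᴸ-comm xs ys f)) (sym (∑ᴸ-distrib-+ ys (f x) _))

  ∑ᴸ-∑ℕ-comm : ∀ (xs : List A) d (f : A → ℕ → ℕ) → ∑ᴸ xs (λ x → ∑ℕ d (f x)) ≡ ∑ℕ d (λ k → ∑ᴸ xs (λ x → f x k))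
  ∑ᴸ-∑ℕ-comm xs zero    f = ∑ᴸ-zero xs (λ _ → refl)
  ∑ᴸ-∑ℕ-comm xs (suc d) f = trans (∑ᴸ-distrib-+ xs (λ x → ∑ℕ d (f x)) (λ x → f x d)) (cong (_+ ∑ᴸ xs (λ x → f x d)) (∑ᴸ-∑ℕ-comm xs d f))

  module Occurrences {A : Set} (_≟_ : DecidableEquality A) where

    occurrences : ∀ {k} → Vec A k → List (Vec A k) → ℕ
    occurrences v xs = ∑ᴸ xs (λ w → χ ⌊ Vec.≡-dec _≟_ v w ⌋)

    occurrences-∷ : ∀ a {k} (v : Vec A k) xs → ∑ᴸ xs (λ w → χ ⌊ Vec.≡-dec _≟_ (a ∷ v) (a ∷ w) ⌋) ≡ occurrences v xs
    occurrences-∷ a v xs = ∑ᴸ-cong xs same-head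
      where
      same-head : ∀ w → χ ⌊ Vec.≡-dec _≟_ (a ∷ v) (a ∷ w) ⌋ ≡ χ ⌊ Vec.≡-dec _≟_ v w ⌋
      same-head w with a ≟ a | Vec.≡-dec _≟_ v w
      ... | yes _  | yes _ = refl
      ... | yes _  | no _  = refl
      ... | no a≢a | _     = contradiction refl a≢a

    occurrences-≢ : ∀ a b → a ≢ b → ∀ {k} (v : Vec A k) xs → ∑ᴸ xs (λ w → χ ⌊ Vec.≡-dec _≟_ (a ∷ v) (b ∷ w) ⌋) ≡ 0
    occurrences-≢ a b a≢b v xs = ∑ᴸ-zero xs other-head
      where
      other-head : ∀ w → χ ⌊ Vec.≡-dec _≟_ (a ∷ v) (b ∷ w) ⌋ ≡ 0
      other-head w with a ≟ b
      ... | yes a≡b = contradiction a≡b a≢b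
      ... | no _    = refl

  ∑ᴸ-allSubsets : ∀ n (f : Subset (suc n) → ℕ) →
    ∑ᴸ (allSubsets (suc n)) f ≡ ∑ᴸ (allSubsets n) (f ∘ (false ∷_)) + ∑ᴸ (allSubsets n) (f ∘ (true ∷_))
  ∑ᴸ-allSubsets n f = trans (∑ᴸ-++ (map (false ∷_) Ss) _ f) (cong₂ _+_ (∑ᴸ-map (false ∷_) Ss f) (∑ᴸ-map (true ∷_) Ss f))
    where
    Ss : List (Subset n)
    Ss = allSubsets n

  module _ where
    open Occurrences Bool._≟_

    occurrences-allSubsets : ∀ n (S : Subset n) → occurrences S (allSubsets n) ≡ 1
    occurrences-allSubsets zero    []      = refl
    occurrences-allSubsets (suc n) (b ∷ S) = trans (∑ᴸ-allSubsets n _) (split b)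
      where
      Ss : List (Subset n)
      Ss = allSubsets n
      term : Bool → Bool → ℕ
      term b b′ = ∑ᴸ Ss (λ w → χ ⌊ Vec.≡-dec Bool._≟_ (b ∷ S) (b′ ∷ w) ⌋)
      here : ∀ b → term b b ≡ 1
      here b = trans (occurrences-∷ b S Ss) (occurrences-allSubsets n S)
      split : ∀ b → term b false + term b true ≡ 1
      split false = cong₂ _+_ (here false) (occurrences-≢ false true (λ ()) S Ss)
      split true  = cong₂ _+_ (occurrences-≢ true false (λ ()) S Ss) (here true)

  allCodes : ∀ m → List (Vec CubeCoord m)
  allCodes zero    = [] ∷ []
  allCodes (suc m) = map (free ∷_) (allCodes m) ++ map (fix0 ∷_) (allCodes m) ++ map (fix1 ∷_) (allCodes m)

  ∑ᴸ-allCodes : ∀ m (f : Vec CubeCoord (suc m) → ℕ) →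
    ∑ᴸ (allCodes (suc m)) f ≡ ∑ᴸ (allCodes m) (f ∘ (free ∷_)) + (∑ᴸ (allCodes m) (f ∘ (fix0 ∷_)) + ∑ᴸ (allCodes m) (f ∘ (fix1 ∷_)))
  ∑ᴸ-allCodes m f = begin
    ∑ᴸ (map (free ∷_) cs ++ map (fix0 ∷_) cs ++ map (fix1 ∷_) cs) f
      ≡⟨ ∑ᴸ-++ (map (free ∷_) cs) _ f ⟩
    ∑ᴸ (map (free ∷_) cs) f + ∑ᴸ (map (fix0 ∷_) cs ++ map (fix1 ∷_) cs) f
      ≡⟨ cong (∑ᴸ (map (free ∷_) cs) f +_) (∑ᴸ-++ (map (fix0 ∷_) cs) _ f) ⟩
    ∑ᴸ (map (free ∷_) cs) f + (∑ᴸ (map (fix0 ∷_) cs) f + ∑ᴸ (map (fix1 ∷_) cs) f)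
      ≡⟨ cong₂ _+_ (∑ᴸ-map (free ∷_) cs f) (cong₂ _+_ (∑ᴸ-map (fix0 ∷_) cs f) (∑ᴸ-map (fix1 ∷_) cs f)) ⟩
    ∑ᴸ cs (f ∘ (free ∷_)) + (∑ᴸ cs (f ∘ (fix0 ∷_)) + ∑ᴸ cs (f ∘ (fix1 ∷_))) ∎
    where
    cs : List (Vec CubeCoord m)
    cs = allCodes m

  module _ where
    open Occurrences _≟ᶜ_

    occurrences-allCodes : ∀ m (c : Vec CubeCoord m) → occurrences c (allCodes m) ≡ 1
    occurrences-allCodes zero    []      = refl
    occurrences-allCodes (suc m) (a ∷ c) = trans (∑ᴸ-allCodes m _) (split a)
      where
      cs : List (Vec CubeCoord m)
      cs = allCodes m
      term : CubeCoord → CubeCoord → ℕ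
      term a b = ∑ᴸ cs (λ w → χ ⌊ Vec.≡-dec _≟ᶜ_ (a ∷ c) (b ∷ w) ⌋)
      here : ∀ a → term a a ≡ 1
      here a = trans (occurrences-∷ a c cs) (occurrences-allCodes m c)
      split : ∀ a → term a free + (term a fix0 + term a fix1) ≡ 1
      split free = cong₂ _+_ (here free) (cong₂ _+_ (occurrences-≢ free fix0 (λ ()) c cs) (occurrences-≢ free fix1 (λ ()) c cs))
      split fix0 = cong₂ _+_ (occurrences-≢ fix0 free (λ ()) c cs) (cong₂ _+_ (here fix0) (occurrences-≢ fix0 fix1 (λ ()) c cs))
      split fix1 = cong₂ _+_ (occurrences-≢ fix1 free (λ ()) c cs) (cong₂ _+_ (occurrences-≢ fix1 fix0 (λ ()) c cs) (here fix1))

  -- Choosing which j of the m coordinates to fix, and whether each is fixed to 0 or 1.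
  count-codimension : ∀ m j → ∑ᴸ (allCodes m) (λ c → χ (codimension c ≡ᵇ j)) ≡ (m C j) * 2 ^ j
  count-codimension zero    zero    = refl
  count-codimension zero    (suc j) = refl
  count-codimension (suc m) zero    = begin
    ∑ᴸ (allCodes (suc m)) (λ c → χ (codimension c ≡ᵇ 0))
      ≡⟨ ∑ᴸ-allCodes m _ ⟩
    ∑ᴸ cs (λ c → χ (codimension c ≡ᵇ 0)) + (∑ᴸ cs (λ _ → 0) + ∑ᴸ cs (λ _ → 0))
      ≡⟨ cong₂ (λ x y → x + (y + y)) (count-codimension m 0) (∑ᴸ-zero cs (λ _ → refl)) ⟩
    1 + (0 + 0) ∎
    where
    cs : List (Vec CubeCoord m)
    cs = allCodes m
  count-codimension (suc m) (suc j) = begin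
    ∑ᴸ (allCodes (suc m)) (λ c → χ (codimension c ≡ᵇ suc j))
      ≡⟨ ∑ᴸ-allCodes m _ ⟩
    ∑ᴸ cs (λ c → χ (codimension c ≡ᵇ suc j)) + (∑ᴸ cs (λ c → χ (codimension c ≡ᵇ j)) + ∑ᴸ cs (λ c → χ (codimension c ≡ᵇ j)))
      ≡⟨ cong₂ (λ x y → x + (y + y)) (count-codimension m (suc j)) (count-codimension m j) ⟩
    (m C suc j) * 2 ^ suc j + ((m C j) * 2 ^ j + (m C j) * 2 ^ j)
      ≡⟨ rearrange (m C j) (m C suc j) (2 ^ j) ⟩
    (m C j + m C suc j) * 2 ^ suc j
      ≡⟨ cong (_* 2 ^ suc j) (nCk+nC[k+1]≡[n+1]C[k+1] m j) ⟩
    (suc m C suc j) * 2 ^ suc j ∎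
    where
    cs : List (Vec CubeCoord m)
    cs = allCodes m
    rearrange : ∀ a b t → b * (2 * t) + (a * t + a * t) ≡ (a + b) * (2 * t)
    rearrange = solve-∀

  module FacesBelow {n} (K : CubicalComplex n) (G : Subset n) (G-face : isFace K G ≡ true) (j : ℕ) where
    open Subfaces K G G-face
    module OnSubsets = Occurrences Bool._≟_
    module OnCodes = Occurrences _≟ᶜ_

    below : Subset n → ℕ
    below T = if isFace K T then (if ⌊ T ⊆? G ⌋ then χ (m ∸ dim K T ≡ᵇ j) else 0) else 0

    weight : Vec CubeCoord m → ℕ
    weight c = χ (codimension c ≡ᵇ j)

    hits : Vec CubeCoord m → Subset n → ℕ
    hits c T = χ ⌊ Vec.≡-dec Bool._≟_ (subface c) T ⌋

    private
      no-hits : ∀ {T} → (∀ c → subface c ≢ T) → ∑ᴸ (allCodes m) (λ c → weight c * hits c T) ≡ 0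
      no-hits {T} missed = ∑ᴸ-zero (allCodes m) λ c → begin
        weight c * hits c T ≡⟨ cong (weight c *_) (χ-no (Vec.≡-dec Bool._≟_ (subface c) T) (missed c)) ⟩
        weight c * 0        ≡⟨ ℕ.*-zeroʳ (weight c) ⟩
        0                   ∎

    -- The subfaces of G are exactly the faces of K contained in G, each hit by one cube face.
    below≡∑ᴸ-hits : ∀ T → below T ≡ ∑ᴸ (allCodes m) (λ c → weight c * hits c T)
    below≡∑ᴸ-hits T with isFace K T in T-face
    ... | false = sym (no-hits λ c eq → contradiction (trans (sym (subst (λ S → isFace K S ≡ true) eq (subface-isFace c))) T-face) λ ())
    ... | true with T ⊆? G
    ...   | no T⊈G = sym (no-hits λ c eq → T⊈G (subst (_⊆ G) eq (subface⊆G c)))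
    ...   | yes T⊆G with subface-surjective T T-face T⊆G
    ...     | c₀ , c₀↦T , codim-c₀ = begin
      χ (m ∸ dim K T ≡ᵇ j)                               ≡⟨ cong (λ x → χ (x ≡ᵇ j)) codim-c₀ ⟩
      weight c₀                                          ≡⟨ ℕ.*-identityʳ (weight c₀) ⟨
      weight c₀ * 1                                      ≡⟨ cong (weight c₀ *_) (occurrences-allCodes m c₀) ⟨
      weight c₀ * OnCodes.occurrences c₀ (allCodes m)    ≡⟨ *-distribˡ-∑ᴸ (allCodes m) (weight c₀) _ ⟩
      ∑ᴸ (allCodes m) (λ c → weight c₀ * χ ⌊ Vec.≡-dec _≟ᶜ_ c₀ c ⌋) ≡⟨ ∑ᴸ-cong (allCodes m) only-c₀ ⟩
      ∑ᴸ (allCodes m) (λ c → weight c * hits c T)        ∎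
      where
      only-c₀ : ∀ c → weight c₀ * χ ⌊ Vec.≡-dec _≟ᶜ_ c₀ c ⌋ ≡ weight c * hits c T
      only-c₀ c with Vec.≡-dec _≟ᶜ_ c₀ c
      ... | yes refl = cong (weight c *_) (sym (χ-yes (Vec.≡-dec Bool._≟_ (subface c) T) c₀↦T))
      ... | no c₀≢c  = begin
        weight c₀ * 0
          ≡⟨ ℕ.*-zeroʳ (weight c₀) ⟩
        0
          ≡⟨ ℕ.*-zeroʳ (weight c) ⟨
        weight c * 0
          ≡⟨ cong (weight c *_) (χ-no (Vec.≡-dec Bool._≟_ (subface c) T) (λ c↦T → c₀≢c (subface-injective (trans c₀↦T (sym c↦T))))) ⟨
        weight c * hits c T  ∎

    count-below : ∑ᴸ (allSubsets n) below ≡ (m C j) * 2 ^ j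
    count-below = begin
      ∑ᴸ Ss below                                             ≡⟨ ∑ᴸ-cong Ss below≡∑ᴸ-hits ⟩
      ∑ᴸ Ss (λ T → ∑ᴸ cs (λ c → weight c * hits c T))         ≡⟨ ∑ᴸ-comm Ss cs _ ⟩
      ∑ᴸ cs (λ c → ∑ᴸ Ss (λ T → weight c * hits c T))         ≡⟨ ∑ᴸ-cong cs (λ c → *-distribˡ-∑ᴸ Ss (weight c) (hits c)) ⟨
      ∑ᴸ cs (λ c → weight c * OnSubsets.occurrences (subface c) Ss)
        ≡⟨ ∑ᴸ-cong cs (λ c → trans (cong (weight c *_) (occurrences-allSubsets n (subface c))) (ℕ.*-identityʳ (weight c))) ⟩
      ∑ᴸ cs weight                                            ≡⟨ count-codimension m j ⟩
      (m C j) * 2 ^ j                                         ∎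
      where
      Ss : List (Subset n)
      Ss = allSubsets n
      cs : List (Vec CubeCoord m)
      cs = allCodes m

  module _ {n} (K : CubicalComplex n) where

    ∑ᴸ-faces-cong : ∀ {f g : Subset n → ℕ} → (∀ S → isFace K S ≡ true → f S ≡ g S) → ∑ᴸ (faces K) f ≡ ∑ᴸ (faces K) g
    ∑ᴸ-faces-cong {f} {g} eq = begin
      ∑ᴸ (faces K) f                                                ≡⟨ ∑ᴸ-filter (isFace K) (allSubsets n) f ⟩
      ∑ᴸ (allSubsets n) (λ S → if isFace K S then f S else 0)       ≡⟨ ∑ᴸ-cong (allSubsets n) on-faces ⟩
      ∑ᴸ (allSubsets n) (λ S → if isFace K S then g S else 0)       ≡⟨ ∑ᴸ-filter (isFace K) (allSubsets n) g ⟨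
      ∑ᴸ (faces K) g                                                ∎
      where
      on-faces : ∀ S → (if isFace K S then f S else 0) ≡ (if isFace K S then g S else 0)
      on-faces S with isFace K S in S-face
      ... | true  = eq S S-face
      ... | false = refl

    ∑ᴸ-faces-by-dim : ∀ d → ((S : Subset n) → isFace K S ≡ true → suc (dim K S) ≤ d) →
                      ∀ (h : ℕ → ℕ) → ∑ᴸ (faces K) (h ∘ dim K) ≡ ∑ℕ d (λ k → h k * fvec K k)
    ∑ᴸ-faces-by-dim d dim< h = begin
      ∑ᴸ (faces K) (h ∘ dim K)
        ≡⟨ ∑ᴸ-faces-cong (λ S S-face → sym (∑ℕ-select d h (dim< S S-face))) ⟩
      ∑ᴸ (faces K) (λ S → ∑ℕ d (λ k → h k * χ (dim K S ≡ᵇ k)))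
        ≡⟨ ∑ᴸ-∑ℕ-comm (faces K) d _ ⟩
      ∑ℕ d (λ k → ∑ᴸ (faces K) (λ S → h k * χ (dim K S ≡ᵇ k)))
        ≡⟨ ∑ℕ-cong d (λ k → trans (sym (*-distribˡ-∑ᴸ (faces K) (h k) _)) (cong (h k *_) (sym (count≡∑ᴸ _ (faces K))))) ⟩
      ∑ℕ d (λ k → h k * fvec K k)                                  ∎

    fvec-sd≡sd-fvector : ∀ d → ((S : Subset n) → isFace K S ≡ true → suc (dim K S) ≤ d) →
                         ∀ j → fvec-sd K j ≡ sd-fvector d (fvec K) j
    fvec-sd≡sd-fvector d dim< j = begin
      fvec-sd K j
        ≡⟨ count≡∑ᴸ _ (sdFaces K) ⟩
      ∑ᴸ (sdFaces K) interval
        ≡⟨ ∑ᴸ-concatMap _ (faces K) interval ⟩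
      ∑ᴸ (faces K) (λ G → ∑ᴸ (concatMap (λ F → if ⌊ F ⊆? G ⌋ then (F , G) ∷ [] else []) (faces K)) interval)
        ≡⟨ ∑ᴸ-cong (faces K) (λ G → trans (∑ᴸ-concatMap _ (faces K) interval) (∑ᴸ-cong (faces K) (singleton G))) ⟩
      ∑ᴸ (faces K) (λ G → ∑ᴸ (faces K) (λ F → if ⌊ F ⊆? G ⌋ then χ (dim K G ∸ dim K F ≡ᵇ j) else 0))
        ≡⟨ ∑ᴸ-faces-cong (λ G G-face → trans (∑ᴸ-filter (isFace K) (allSubsets n) _) (FacesBelow.count-below K G G-face j)) ⟩
      ∑ᴸ (faces K) (λ G → (dim K G C j) * 2 ^ j)
        ≡⟨ ∑ᴸ-faces-by-dim d dim< (λ k → (k C j) * 2 ^ j) ⟩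
      sd-fvector d (fvec K) j ∎
      where
      interval : Subset n × Subset n → ℕ
      interval I = χ (sdDim K I ≡ᵇ j)
      singleton : ∀ G F → ∑ᴸ (if ⌊ F ⊆? G ⌋ then (F , G) ∷ [] else []) interval ≡ (if ⌊ F ⊆? G ⌋ then χ (dim K G ∸ dim K F ≡ᵇ j) else 0)
      singleton G F with ⌊ F ⊆? G ⌋
      ... | true  = ℕ.+-identityʳ _
      ... | false = refl

open CubicalHVectors using (symmetric-hc-sd)
open FaceCounting using (fvec-sd≡sd-fvector)

corollary4p3 : {n : ℕ} (K : CubicalComplex n) (d : ℕ) → HasDimension K d →
                   Symmetric d (hc d (fvec K)) →
                   Symmetric d (hc d (fvec-sd K))
corollary4p3 K zero    (_ , _ , _ , ())
corollary4p3 K (suc m) (dim< , _) =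
  symmetric-hc-sd m (fvec K) (fvec-sd K) (fvec-sd≡sd-fvector K (suc m) dim<)
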